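{- Let $G$ be the modified network of a planar network with $n$ sources and sinks, let $p\ge q\ge1$, let $X,Y\subseteq[n]$ be disjoint with $|Y|=p+q$, let $\gamma=\gamma_Y:[p+q]\to Y$ be the order-preserving bijection, let $A\subseteq[p+q]$ with $|A|=p$, $\bar A=[p+q]-A$, $I(A)=X\cup\gamma(A)$, $J(A)=X\cup\gamma(\bar A)$. Let $\phi$ be an $I(A)$-flow and $\phi'$ a $J(A)$-flow in $G$. Then $E_\phi\triangle E_{\phi'}$ is partitioned into the edge sets of pairwise (vertex-)disjoint circuits $C_1,\dots,C_d$ (for some $d\ge0$) and simple paths $P_1,\dots,P_p$, where each $P_i$ connects a source in $\hat S_{\gamma(A)}$ with either a source in $\hat S_{\gamma(\bar A)}$ or a sink in $\tilde T:=\hat T_{|X|+p}-\hat T_{|X|+q}$. Moreover, in each of these circuits and paths, the edges of $\phi$ and the edges of $\phi'$ have opposite directions (when traversing it, the edges of $\phi$ are all forward and the edges of $\phi'$ are all backward, or vice versa).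
   Context: A planar network is a finite, weakly connected, acyclic directed graph embedded in the plane with sources $s_1,\dots,s_n$ and sinks $t_1,\dots,t_n$ on the outer face boundary in cyclic order $s_n,\dots,s_1,t_1,\dots,t_n$ (possibly $s_1=t_1$ or $s_n=t_n$). Its modified network is obtained by: replacing each vertex $v$ by two vertices $v',v''$ joined by a split-edge $(v',v'')$; replacing each edge $(u,v)$ by an edge $(u'',v')$; adding new sources $\hat s_i$ with edges $(\hat s_i,s_i')$ and new sinks $\hat t_j$ with edges $(t_j'',\hat t_j)$, $i,j\in[n]$. For $K\subseteq[n]$ write $\hat S_K=\{\hat s_i:i\in K\}$ and $\hat T_k=\{\hat t_1,\dots,\hat t_k\}$. A $K$-flow in the modified network is a collection $\phi$ of $|K|$ pairwise vertex-disjoint directed paths from $\hat S_K$ to $\hat T_{|K|}$; $E_\phi$ is its edge set. $\triangle$ is symmetric difference. Paths and circuits here are in the underlying undirected sense: a path is a sequence of vertices and edges, each edge joining consecutive vertices in either direction (forward or backward); it is simple if its vertices are distinct; a circuit is a closed such path with distinct vertices apart from the repeated endpoint. -}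

module Defs where

open import Data.Nat using (ℕ; _+_; _≤_; _<_)
open import Data.Fin using (Fin; toℕ) renaming (_<_ to _<ᶠ_)
open import Data.Fin.Properties using (any?; _≟_)
open import Data.Fin.Subset using (Subset; _∈_; _∉_; _∪_; ∁; ∣_∣)
open import Data.Fin.Subset.Properties using (_∈?_)
open import Data.Vec using (tabulate)
open import Data.List using (List; []; _∷_; map)
open import Data.List.Relation.Unary.All using (All)
open import Data.List.Relation.Unary.Unique.Propositional using (Unique)
open import Data.List.Membership.Propositional using () renaming (_∈_ to _∈ₗ_)
open import Data.Product using (Σ; ∃; ∃-syntax; _×_; _,_; proj₁; proj₂)
open import Data.Sum using (_⊎_)
open import Data.Unit using (⊤)
open import Data.Empty using (⊥)
open import Relation.Nullary using (¬_; does)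
open import Relation.Nullary.Decidable using (_×-dec_)
open import Relation.Binary.PropositionalEquality using (_≡_; _≢_)

data Dir : Set where
  fwd bwd : Dir

record Digraph : Set₁ where
  field
    Vtx : Set
    Edg : Set
    tl  : Edg → Vtx
    hd  : Edg → Vtx

module _ (G : Digraph) where
  open Digraph G

  Step : Set
  Step = Edg × Dir

  stepSrc : Step → Vtx
  stepSrc (e , fwd) = tl e
  stepSrc (e , bwd) = hd e

  stepTgt : Step → Vtx
  stepTgt (e , fwd) = hd e
  stepTgt (e , bwd) = tl e

  ValidFrom : Vtx → List Step → Set
  ValidFrom v []       = ⊤
  ValidFrom v (s ∷ ss) = (stepSrc s ≡ v) × ValidFrom (stepTgt s) ss

  vertsFrom : Vtx → List Step → List Vtx
  vertsFrom v []       = v ∷ []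
  vertsFrom v (s ∷ ss) = v ∷ vertsFrom (stepTgt s) ss

  endFrom : Vtx → List Step → Vtx
  endFrom v []       = v
  endFrom v (s ∷ ss) = endFrom (stepTgt s) ss

  -- a walk (path in the underlying undirected sense, vertices may repeat)
  record Walk : Set where
    constructor walk
    field
      start : Vtx
      steps : List Step
      valid : ValidFrom start steps

  open Walk public

  finish : Walk → Vtx
  finish w = endFrom (start w) (steps w)

  verts : Walk → List Vtx
  verts w = vertsFrom (start w) (steps w)

  edgesW : Walk → List Edg
  edgesW w = map proj₁ (steps w)

  IsSimplePath : Walk → Set
  IsSimplePath w = Unique (verts w)

  tailList : List Vtx → List Vtx
  tailList []       = []
  tailList (_ ∷ xs) = xs

  IsCircuit : Walk → Set
  IsCircuit w = (steps w ≢ []) × (finish w ≡ start w)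
              × Unique (tailList (verts w)) × Unique (edgesW w)

  IsDirected : Walk → Set
  IsDirected w = All (λ s → proj₂ s ≡ fwd) (steps w)

  VDisjoint : Walk → Walk → Set
  VDisjoint w w' = ∀ v → v ∈ₗ verts w → v ∈ₗ verts w' → ⊥

-- Networks (the planar embedding is not encoded)

record Network (n : ℕ) : Set where
  field
    nV  : ℕ
    nE  : ℕ
    tl  : Fin nE → Fin nV
    hd  : Fin nE → Fin nV
    src : Fin n → Fin nV
    snk : Fin n → Fin nV

  graph : Digraph
  graph = record { Vtx = Fin nV ; Edg = Fin nE ; tl = tl ; hd = hd }

  Acyclic : Set
  Acyclic = ∀ (w : Walk graph) → IsDirected graph w → steps w ≢ []
          → finish graph w ≢ start w

  WeaklyConnected : Set
  WeaklyConnected = ∀ u v → Σ (Walk graph) λ w →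
                      (start w ≡ u) × (finish graph w ≡ v)

module _ {n : ℕ} (N : Network n) where
  open Network N

  data MV : Set where
    vin  : Fin nV → MV
    vout : Fin nV → MV
    shat : Fin n → MV
    that : Fin n → MV

  data ME : Set where
    split : Fin nV → ME
    orig  : Fin nE → ME
    sedge : Fin n → ME
    tedge : Fin n → ME

  mtl : ME → MV
  mtl (split v) = vin v
  mtl (orig e)  = vout (tl e)
  mtl (sedge i) = shat i
  mtl (tedge j) = vout (snk j)

  mhd : ME → MV
  mhd (split v) = vout v
  mhd (orig e)  = vin (hd e)
  mhd (sedge i) = vin (src i)
  mhd (tedge j) = that j

  Modified : Digraph
  Modified = record { Vtx = MV ; Edg = ME ; tl = mtl ; hd = mhd }

  record Flow (K : Subset n) : Set where
    field
      path     : Fin ∣ K ∣ → Walk Modified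
      directed : ∀ i → IsDirected Modified (path i)
      simple   : ∀ i → IsSimplePath Modified (path i)
      fromS    : ∀ i → ∃[ k ] (k ∈ K × start (path i) ≡ shat k)
      toT      : ∀ i → ∃[ j ] (toℕ j < ∣ K ∣ × finish Modified (path i) ≡ that j)
      disjoint : ∀ i j → i ≢ j → VDisjoint Modified (path i) (path j)

  InFlow : ∀ {K} → Flow K → ME → Set
  InFlow φ e = ∃[ i ] (e ∈ₗ edgesW Modified (Flow.path φ i))

SymDiff : {E : Set} → (E → Set) → (E → Set) → E → Set
SymDiff P Q e = (P e × ¬ Q e) ⊎ (Q e × ¬ P e)

image : ∀ {m n} → (Fin m → Fin n) → Subset m → Subset n
image f A = tabulate λ y → does (any? (λ i → (i ∈? A) ×-dec (f i ≟ y)))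

IsOrderBij : ∀ {m n} → (Fin m → Fin n) → Subset n → Set
IsOrderBij γ Y = (∀ i j → i <ᶠ j → γ i <ᶠ γ j)
               × (∀ i → γ i ∈ Y)
               × (∀ y → y ∈ Y → ∃[ i ] (γ i ≡ y))

module _ {n : ℕ} (N : Network n) (p q : ℕ) (X : Subset n)
         (γ : Fin (p + q) → Fin n) (A : Subset (p + q))
         (Eφ Eφ' : ME N → Set) where

  private G = Modified N

  Δ : ME N → Set
  Δ = SymDiff Eφ Eφ'

  SrcA : MV N → Set
  SrcA v = ∃[ a ] (a ∈ A × v ≡ shat (γ a))

  -- source in Ŝ_{γ(Ā)} or sink in T̃ = T̂_{|X|+p} - T̂_{|X|+q}
  -- (sinks are 0-indexed here: t̂_j with |X|+q ≤ j < |X|+p)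
  OtherEnd : MV N → Set
  OtherEnd v = (∃[ b ] (b ∉ A × v ≡ shat (γ b)))
             ⊎ (∃[ j ] (∣ X ∣ + q ≤ toℕ j × toℕ j < ∣ X ∣ + p × v ≡ that j))

  Connects : Walk G → Set
  Connects w = (SrcA (start w) × OtherEnd (finish G w))
             ⊎ (SrcA (finish G w) × OtherEnd (start w))

  Alternating : Walk G → Set
  Alternating w =
      (All (λ s → Eφ (proj₁ s) → proj₂ s ≡ fwd) (steps w)
       × All (λ s → Eφ' (proj₁ s) → proj₂ s ≡ bwd) (steps w))
    ⊎ (All (λ s → Eφ (proj₁ s) → proj₂ s ≡ bwd) (steps w)
       × All (λ s → Eφ' (proj₁ s) → proj₂ s ≡ fwd) (steps w))

  record Decomposition : Set where
    field
      d        : ℕ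
      C        : Fin d → Walk G
      P        : Fin p → Walk G
      C-circ   : ∀ k → IsCircuit G (C k)
      P-simple : ∀ k → IsSimplePath G (P k)
      cover    : ∀ e → Δ e → (∃[ k ] (e ∈ₗ edgesW G (C k)))
                               ⊎ (∃[ k ] (e ∈ₗ edgesW G (P k)))
      C-in-Δ   : ∀ k e → e ∈ₗ edgesW G (C k) → Δ e
      P-in-Δ   : ∀ k e → e ∈ₗ edgesW G (P k) → Δ e
      disjCC   : ∀ k l → k ≢ l → VDisjoint G (C k) (C l)
      disjPP   : ∀ k l → k ≢ l → VDisjoint G (P k) (P l)
      disjCP   : ∀ k l → VDisjoint G (C k) (P l)
      P-ends   : ∀ k → Connects (P k)
      C-alt    : ∀ k → Alternating (C k)
      P-alt    : ∀ k → Alternating (P k)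

module Submission where

-- Call a step of the modified network an *arrow* if it runs
-- forward along an edge of E_φ − E_φ' or backward along an edge of
-- E_φ' − E_φ; the arrows are exactly the edges of E_φ △ E_φ', oriented so
-- that φ-edges are forward and φ'-edges backward.  Because φ and φ' are
-- families of vertex-disjoint directed simple paths, every vertex has at
-- most one outgoing and at most one incoming arrow, and at the split
-- vertices v', v'' an arrow leaves iff an arrow arrives.  Hence following
-- arrows is a partial injection on the finite vertex set, whose orbits are
-- disjoint circuits and maximal simple paths; the paths start exactly at
-- the sources ŝ_γ(a) (a ∈ A) and end at sources of Ŝ_γ(Ā) or sinks in T̃.

module ListFacts where

  open import Data.Nat using (suc; _≤_; z≤n; s≤s)
  open import Data.Nat.Properties using (≤-trans; <-≤-trans; n≮n)
  open import Data.Fin using (zero; suc)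
  open import Data.List using (List; []; _∷_; length; filter; lookup; find)
  open import Data.List.Properties using (filter-notAll)
  open import Data.List.Relation.Unary.All using (All; _∷_)
  import Data.List.Relation.Unary.All as All
  open import Data.List.Relation.Unary.Any using (Any; here; there)
  open import Data.List.Relation.Unary.AllPairs using (_∷_)
  open import Data.List.Relation.Unary.Unique.Propositional using (Unique)
  open import Data.List.Membership.Propositional using (_∈_)
  open import Data.List.Membership.Propositional.Properties using (∈-filter⁺; ∈-lookup)
  open import Data.Maybe using (just)
  open import Data.Product using (∃-syntax; _,_)
  open import Data.Empty using (⊥-elim)
  open import Relation.Nullary using (¬_; yes; no; ¬?)
  open import Relation.Unary using (Decidable)
  open import Relation.Binary.Definitions using (DecidableEquality)
  open import Relation.Binary.PropositionalEquality using (_≡_; refl; sym; cong)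

  module Pigeonhole {A : Set} (_≟_ : DecidableEquality A) where

    open import Data.List.Membership.DecPropositional _≟_ using (_∈?_)

    -- A duplicate-free list contained in ys is no longer than ys
    -- (remove its head from ys and recurse).
    unique-length-≤ : ∀ {xs ys : List A} → Unique xs → (∀ {x} → x ∈ xs → x ∈ ys)
                    → length xs ≤ length ys
    unique-length-≤ {[]} _ _ = z≤n
    unique-length-≤ {x ∷ xs} {ys} (x∉xs ∷ u) xs⊆ys = ≤-trans (s≤s shorter) removed
      where
      differs : Decidable (λ y → ¬ x ≡ y)
      differs y = ¬? (x ≟ y)
      xs⊆ys-x : ∀ {y} → y ∈ xs → y ∈ filter differs ys
      xs⊆ys-x m = ∈-filter⁺ differs (xs⊆ys (there m)) (All.lookup x∉xs m)
      shorter : length xs ≤ length (filter differs ys)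
      shorter = unique-length-≤ u xs⊆ys-x
      x-present : ∀ {zs} → x ∈ zs → Any (λ y → ¬ (¬ x ≡ y)) zs
      x-present (here p) = here (λ x≢y → x≢y p)
      x-present (there m) = there (x-present m)
      removed : suc (length (filter differs ys)) ≤ length ys
      removed = filter-notAll differs ys (x-present (xs⊆ys (here refl)))

    -- A duplicate-free list contained in ys and at least as long as ys
    -- contains every element of ys: a missing y could be added to it.
    unique-⊆-covers : ∀ {xs ys : List A} → Unique xs → (∀ {x} → x ∈ xs → x ∈ ys)
                    → length ys ≤ length xs → ∀ {y} → y ∈ ys → y ∈ xs
    unique-⊆-covers {xs} {ys} u xs⊆ys ys≤xs {y} y∈ys with y ∈? xs
    ... | yes y∈xs = y∈xs
    ... | no y∉xs = ⊥-elim (n≮n (length xs) (<-≤-trans (unique-length-≤ u' sub') ys≤xs))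
      where
      u' : Unique (y ∷ xs)
      u' = All.tabulate (λ { z∈xs refl → y∉xs z∈xs }) ∷ u
      sub' : ∀ {z} → z ∈ y ∷ xs → z ∈ ys
      sub' (here refl) = y∈ys
      sub' (there m) = xs⊆ys m

  lookup-injective : ∀ {A : Set} {xs : List A} → Unique xs
                   → ∀ i j → lookup xs i ≡ lookup xs j → i ≡ j
  lookup-injective {xs = x ∷ xs} (x∉ ∷ u) zero zero eq = refl
  lookup-injective {xs = x ∷ xs} (x∉ ∷ u) zero (suc j) eq = ⊥-elim (All.lookup x∉ (∈-lookup j) eq)
  lookup-injective {xs = x ∷ xs} (x∉ ∷ u) (suc i) zero eq = ⊥-elim (All.lookup x∉ (∈-lookup i) (sym eq))
  lookup-injective {xs = x ∷ xs} (x∉ ∷ u) (suc i) (suc j) eq = cong suc (lookup-injective u i j eq)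

  find-sound : ∀ {A : Set} {P : A → Set} (P? : Decidable P) xs {a}
             → find P? xs ≡ just a → P a
  find-sound P? (x ∷ xs) eq with P? x
  find-sound P? (x ∷ xs) refl | yes px = px
  ... | no _ = find-sound P? xs eq

  find-complete : ∀ {A : Set} {P : A → Set} (P? : Decidable P) xs {a}
                → P a → a ∈ xs → ∃[ a' ] (find P? xs ≡ just a')
  find-complete P? (x ∷ xs) pa m with P? x
  ... | yes _ = x , refl
  find-complete P? (x ∷ xs) pa (here refl) | no ¬px = ⊥-elim (¬px pa)
  find-complete P? (x ∷ xs) pa (there m) | no _ = find-complete P? xs pa m

module WalkFacts where

  open import Defs
  open import Data.List using (List; []; _∷_; map)
  open import Data.List.Relation.Unary.All using (All; []; _∷_)
  import Data.List.Relation.Unary.All as All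
  open import Data.List.Relation.Unary.Any using (here; there)
  open import Data.List.Relation.Unary.AllPairs using ([]; _∷_)
  open import Data.List.Relation.Unary.Unique.Propositional using (Unique)
  open import Data.List.Membership.Propositional using (_∈_; _∉_)
  open import Data.List.Membership.Propositional.Properties using (∈-map⁺; ∈-map⁻)
  open import Data.Product using (Σ; ∃-syntax; _×_; _,_; proj₁; proj₂)
  open import Data.Sum using (_⊎_; inj₁; inj₂)
  open import Data.Empty using (⊥; ⊥-elim)
  open import Relation.Binary.PropositionalEquality using (_≡_; _≢_; refl; sym; trans; cong; subst)

  module _ (G : Digraph) where
    open Digraph G

    private
      src tgt : Step G → Vtx
      src = stepSrc G
      tgt = stepTgt G

    unique-head : ∀ {A : Set} {x : A} {xs} → Unique (x ∷ xs) → x ∉ xs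
    unique-head (x∉ ∷ _) m = All.lookup x∉ m refl

    unique-tail : ∀ {A : Set} {x : A} {xs} → Unique (x ∷ xs) → Unique xs
    unique-tail (_ ∷ u) = u

    verts-targets : ∀ {v ss} → ValidFrom G v ss → vertsFrom G v ss ≡ v ∷ map tgt ss
    verts-targets {v} {[]} _ = refl
    verts-targets {v} {s ∷ ss} (_ , ok) = cong (v ∷_) (verts-targets ok)

    verts-nonempty : ∀ w ss → Σ (List Vtx) λ r → vertsFrom G w ss ≡ w ∷ r
    verts-nonempty w [] = [] , refl
    verts-nonempty w (s ∷ ss) = _ , refl

    start∈verts : ∀ v ss → v ∈ vertsFrom G v ss
    start∈verts v [] = here refl
    start∈verts v (_ ∷ _) = here refl

    end∈verts : ∀ v ss → endFrom G v ss ∈ vertsFrom G v ss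
    end∈verts v [] = here refl
    end∈verts v (s ∷ ss) = there (end∈verts (tgt s) ss)

    src∈verts : ∀ {v ss s} → ValidFrom G v ss → s ∈ ss → src s ∈ vertsFrom G v ss
    src∈verts {ss = s ∷ ss} (e , ok) (here refl) = here e
    src∈verts {ss = s ∷ ss} (e , ok) (there m) = there (src∈verts ok m)

    tailList⊆ : ∀ {x : Vtx} {l} → x ∈ tailList G l → x ∈ l
    tailList⊆ {l = []} ()
    tailList⊆ {l = _ ∷ _} m = there m

    tgt∈tailVerts : ∀ {v ss s} → ValidFrom G v ss → s ∈ ss → tgt s ∈ tailList G (vertsFrom G v ss)
    tgt∈tailVerts {ss = s ∷ ss} (e , ok) (here refl) = start∈verts (tgt s) ss
    tgt∈tailVerts {ss = s ∷ ss} (e , ok) (there m) = tailList⊆ (tgt∈tailVerts ok m)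

    simple⇒src-injective : ∀ {v ss s1 s2} → ValidFrom G v ss → Unique (vertsFrom G v ss)
                         → s1 ∈ ss → s2 ∈ ss → src s1 ≡ src s2 → s1 ≡ s2
    simple⇒src-injective {ss = s ∷ ss} (e , ok) u (here refl) (here refl) eq = refl
    simple⇒src-injective {ss = s ∷ ss} (e , ok) u (here refl) (there m) eq =
      ⊥-elim (unique-head u (subst (_∈ vertsFrom G (tgt s) ss) (trans (sym eq) e) (src∈verts ok m)))
    simple⇒src-injective {ss = s ∷ ss} (e , ok) u (there m) (here refl) eq =
      ⊥-elim (unique-head u (subst (_∈ vertsFrom G (tgt s) ss) (trans eq e) (src∈verts ok m)))
    simple⇒src-injective {ss = s ∷ ss} (e , ok) u (there m1) (there m2) eq =
      simple⇒src-injective ok (unique-tail u) m1 m2 eq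

    later-target : ∀ {v s ss} → Unique (v ∷ vertsFrom G (tgt s) ss)
                 → tgt s ∈ tailList G (vertsFrom G (tgt s) ss) → ⊥
    later-target {s = s} {ss} u m with verts-nonempty (tgt s) ss
    ... | r , eq rewrite eq = unique-head (unique-tail u) m

    simple⇒tgt-injective : ∀ {v ss s1 s2} → ValidFrom G v ss → Unique (vertsFrom G v ss)
                         → s1 ∈ ss → s2 ∈ ss → tgt s1 ≡ tgt s2 → s1 ≡ s2
    simple⇒tgt-injective {ss = s ∷ ss} (e , ok) u (here refl) (here refl) eq = refl
    simple⇒tgt-injective {ss = s ∷ ss} (e , ok) u (here refl) (there m) eq =
      ⊥-elim (later-target {s = s} {ss} u
        (subst (λ x → x ∈ tailList G (vertsFrom G (tgt s) ss)) (sym eq) (tgt∈tailVerts ok m)))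
    simple⇒tgt-injective {ss = s ∷ ss} (e , ok) u (there m) (here refl) eq =
      ⊥-elim (later-target {s = s} {ss} u
        (subst (λ x → x ∈ tailList G (vertsFrom G (tgt s) ss)) eq (tgt∈tailVerts ok m)))
    simple⇒tgt-injective {ss = s ∷ ss} (e , ok) u (there m1) (there m2) eq =
      simple⇒tgt-injective ok (unique-tail u) m1 m2 eq

    next-step : ∀ {v ss s} → ValidFrom G v ss → s ∈ ss
              → tgt s ≡ endFrom G v ss ⊎ ∃[ s' ] (s' ∈ ss × src s' ≡ tgt s)
    next-step {ss = s ∷ []} (e , ok) (here refl) = inj₁ refl
    next-step {ss = s ∷ s' ∷ ss} (e , e' , ok) (here refl) = inj₂ (s' , there (here refl) , e')
    next-step {ss = s ∷ ss} (e , ok) (there m) with next-step ok m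
    ... | inj₁ x = inj₁ x
    ... | inj₂ (s' , m' , q) = inj₂ (s' , there m' , q)

    previous-step : ∀ {v ss s} → ValidFrom G v ss → s ∈ ss
                  → src s ≡ v ⊎ ∃[ s' ] (s' ∈ ss × tgt s' ≡ src s)
    previous-step {ss = s ∷ ss} (e , ok) (here refl) = inj₁ e
    previous-step {ss = s ∷ ss} (e , ok) (there m) with previous-step ok m
    ... | inj₁ x = inj₂ (s , here refl , sym x)
    ... | inj₂ (s' , m' , q) = inj₂ (s' , there m' , q)

    first-step : ∀ {v ss} → ValidFrom G v ss → ss ≢ [] → ∃[ s ] (s ∈ ss × src s ≡ v)
    first-step {ss = []} _ ne = ⊥-elim (ne refl)
    first-step {ss = s ∷ ss} (e , ok) _ = s , here refl , e

    last-step : ∀ {v ss} → ValidFrom G v ss → ss ≢ [] → ∃[ s ] (s ∈ ss × tgt s ≡ endFrom G v ss)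
    last-step {ss = []} _ ne = ⊥-elim (ne refl)
    last-step {ss = s ∷ []} (e , ok) ne = s , here refl , refl
    last-step {ss = s ∷ s' ∷ ss} (e , ok) ne with last-step ok (λ ())
    ... | s'' , m , q = s'' , there m , q

    vertex-end-or-src : ∀ {v ss x} → ValidFrom G v ss → x ∈ vertsFrom G v ss
                      → x ≡ endFrom G v ss ⊎ ∃[ s ] (s ∈ ss × src s ≡ x)
    vertex-end-or-src {ss = []} _ (here refl) = inj₁ refl
    vertex-end-or-src {ss = s ∷ ss} (e , ok) (here refl) = inj₂ (s , here refl , e)
    vertex-end-or-src {ss = s ∷ ss} (e , ok) (there m) with vertex-end-or-src ok m
    ... | inj₁ x = inj₁ x
    ... | inj₂ (s' , m' , q) = inj₂ (s' , there m' , q)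

    directed-step : ∀ {ss : List (Step G)} {e : Edg} → All (λ s → proj₂ s ≡ fwd) ss
                  → e ∈ map proj₁ ss → (e , fwd) ∈ ss
    directed-step ad m with ∈-map⁻ proj₁ m
    ... | (e' , d) , m' , refl with All.lookup ad m'
    ... | refl = m'

    distinct-targets⇒distinct-edges : (Arr : Step G → Set)
      → (∀ {e d d'} → Arr (e , d) → Arr (e , d') → d ≡ d')
      → ∀ {ss} → All Arr ss → Unique (map tgt ss) → Unique (map proj₁ ss)
    distinct-targets⇒distinct-edges Arr det {[]} _ _ = []
    distinct-targets⇒distinct-edges Arr det {s ∷ ss} (a ∷ as) (t∉ ∷ u) =
      All.tabulate (λ m eq → edge-fresh s a m eq t∉) ∷ distinct-targets⇒distinct-edges Arr det as u
      where
      edge-fresh : ∀ s' {e} → Arr s' → e ∈ map proj₁ ss → proj₁ s' ≡ e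
                 → All (tgt s' ≢_) (map tgt ss) → ⊥
      edge-fresh (e0 , d) a' m eq t∉' with ∈-map⁻ proj₁ m
      ... | (e' , d') , m' , refl with eq
      ... | refl with det a' (All.lookup as m')
      ... | refl = All.lookup t∉' (∈-map⁺ tgt m') refl

module Iteration where

  open import Data.Nat using (ℕ; zero; suc)
  open import Data.Bool using (Bool; true; false)
  open import Data.Maybe using (Maybe; just; nothing)
  open import Data.Maybe.Properties using (just-injective)
  open import Data.List using (List; []; _∷_; length)
  open import Data.List.Relation.Unary.All using (All; []; _∷_)
  import Data.List.Relation.Unary.All as All
  open import Data.List.Relation.Unary.Any using (here; there)
  open import Data.List.Relation.Unary.AllPairs using ([]; _∷_)
  open import Data.List.Relation.Unary.Unique.Propositional using (Unique)
  open import Data.List.Membership.Propositional using (_∈_)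
  open import Data.Product using (∃-syntax; _×_; _,_)
  open import Data.Sum using (_⊎_; inj₁; inj₂)
  open import Data.Empty using (⊥-elim)
  open import Relation.Nullary using (yes; no; does)
  open import Relation.Binary.Definitions using (DecidableEquality)
  open import Relation.Binary.PropositionalEquality using (_≡_; _≢_; refl; sym; trans; cong)

  module Iterate {V : Set} (_≟_ : DecidableEquality V) (g : V → Maybe V) where

    open import Data.List.Membership.DecPropositional _≟_ using (_∈?_)

    module Until (stop : V → Bool) where
      mutual
        trajectory : ℕ → V → List V
        trajectory f v = v ∷ continue f v

        continue : ℕ → V → List V
        continue zero v = []
        continue (suc f) v = continueWith f (stop v) (g v)

        continueWith : ℕ → Bool → Maybe V → List V
        continueWith f true _ = []
        continueWith f false nothing = []
        continueWith f false (just w) = trajectory f w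

      endpoint : ℕ → V → V
      endpointWith : ℕ → V → Bool → Maybe V → V
      endpoint zero v = v
      endpoint (suc f) v = endpointWith f v (stop v) (g v)
      endpointWith f v true _ = v
      endpointWith f v false nothing = v
      endpointWith f v false (just w) = endpoint f w

      continue-predecessor : ∀ f v {x} → x ∈ continue f v
                           → ∃[ y ] (y ∈ trajectory f v × stop y ≡ false × g y ≡ just x)
      continue-predecessor zero v ()
      continue-predecessor (suc f) v m with stop v in es | g v in eg
      continue-predecessor (suc f) v () | true | _
      continue-predecessor (suc f) v () | false | nothing
      continue-predecessor (suc f) v (here refl) | false | just w = v , here refl , es , eg
      continue-predecessor (suc f) v (there m) | false | just w with continue-predecessor f w m
      ... | y , m' , sy , gy = y , there m' , sy , gy

      predecessor : ∀ f v {x} → x ∈ trajectory f v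
                  → x ≡ v ⊎ ∃[ y ] (y ∈ trajectory f v × stop y ≡ false × g y ≡ just x)
      predecessor f v (here p) = inj₁ p
      predecessor f v (there m) = inj₂ (continue-predecessor f v m)

      unique-or-returns : (∀ {x x' y} → g x ≡ just y → g x' ≡ just y → x ≡ x')
        → ∀ f v → Unique (trajectory f v)
                  ⊎ ∃[ y ] (y ∈ trajectory f v × stop y ≡ false × g y ≡ just v)
      unique-or-returns g-inj zero v = inj₁ ([] ∷ [])
      unique-or-returns g-inj (suc f) v with stop v in es | g v in eg
      ... | true | _ = inj₁ ([] ∷ [])
      ... | false | nothing = inj₁ ([] ∷ [])
      ... | false | just w with unique-or-returns g-inj f w
      ...   | inj₁ u with v ∈? trajectory f w
      ...     | no v∉ = inj₁ (All.tabulate (λ { m refl → v∉ m }) ∷ u)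
      ...     | yes m = inj₂ (back m)
        where
        back : v ∈ trajectory f w → ∃[ y ] (y ∈ v ∷ trajectory f w × stop y ≡ false × g y ≡ just v)
        back m' with predecessor f w m'
        ... | inj₁ refl = v , here refl , es , eg
        ... | inj₂ (y , m'' , sy , gy) = y , there m'' , sy , gy
      unique-or-returns g-inj (suc f) v | false | just w | inj₂ (y , m , sy , gy) with g-inj gy eg
      ...   | refl with predecessor f w m
      ...     | inj₁ refl = inj₂ (y , here refl , sy , gy)
      ...     | inj₂ (y' , m' , sy' , gy') = inj₂ (y' , there m' , sy' , gy')

      Terminated : ℕ → V → Set
      Terminated f v = stop (endpoint f v) ≡ true ⊎ g (endpoint f v) ≡ nothing

      full-or-terminated : ∀ f v → length (trajectory f v) ≡ suc f ⊎ Terminated f v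
      full-or-terminated zero v = inj₁ refl
      full-or-terminated (suc f) v with stop v in es | g v in eg
      ... | true | _ = inj₂ (inj₁ es)
      ... | false | nothing = inj₂ (inj₂ eg)
      ... | false | just w with full-or-terminated f w
      ...   | inj₁ eq = inj₁ (cong suc eq)
      ...   | inj₂ t = inj₂ t

      endpoint∈ : ∀ f v → endpoint f v ∈ trajectory f v
      endpoint∈ zero v = here refl
      endpoint∈ (suc f) v with stop v | g v
      ... | true | _ = here refl
      ... | false | nothing = here refl
      ... | false | just w = there (endpoint∈ f w)

      module _ (P : V → Set) (closed : ∀ {x y} → P x → g x ≡ just y → P y) where
        all-closed : ∀ f v → P v → All P (trajectory f v)
        all-closed zero v p = p ∷ []
        all-closed (suc f) v p with stop v | g v in eg
        ... | true | _ = p ∷ []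
        ... | false | nothing = p ∷ []
        ... | false | just w = p ∷ all-closed f w (closed p eg)

        endpoint-closed : ∀ f v {x} → x ∈ trajectory f v → P x → P (endpoint f v)
        endpoint-closed zero v (here refl) p = p
        endpoint-closed (suc f) v m p with stop v | g v in eg
        endpoint-closed (suc f) v (here refl) p | true | _ = p
        endpoint-closed (suc f) v (here refl) p | false | nothing = p
        endpoint-closed (suc f) v (here refl) p | false | just w =
          endpoint-closed f w (here refl) (closed p eg)
        endpoint-closed (suc f) v (there m) p | false | just w = endpoint-closed f w m p

      dead-end-is-endpoint : ∀ f v {x} → x ∈ trajectory f v → g x ≡ nothing → x ≡ endpoint f v
      dead-end-is-endpoint zero v (here refl) _ = refl
      dead-end-is-endpoint (suc f) v m gx with stop v | g v in eg
      dead-end-is-endpoint (suc f) v (here refl) gx | true | _ = refl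
      dead-end-is-endpoint (suc f) v (here refl) gx | false | nothing = refl
      dead-end-is-endpoint (suc f) v (here refl) gx | false | just w with trans (sym eg) gx
      ... | ()
      dead-end-is-endpoint (suc f) v (there m) gx | false | just w = dead-end-is-endpoint f w m gx

      stop-is-endpoint : ∀ f v {x} → x ∈ trajectory f v → stop x ≡ true → x ≡ endpoint f v
      stop-is-endpoint zero v (here refl) _ = refl
      stop-is-endpoint (suc f) v m sx with stop v in es | g v
      stop-is-endpoint (suc f) v (here refl) sx | true | _ = refl
      stop-is-endpoint (suc f) v (here refl) sx | false | _ with trans (sym es) sx
      ... | ()
      stop-is-endpoint (suc f) v (there m) sx | false | just w = stop-is-endpoint f w m sx

      endpoint-start-or-image : ∀ f v → endpoint f v ≡ v ⊎ ∃[ y ] (g y ≡ just (endpoint f v))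
      endpoint-start-or-image zero v = inj₁ refl
      endpoint-start-or-image (suc f) v with stop v | g v in eg
      ... | true | _ = inj₁ refl
      ... | false | nothing = inj₁ refl
      ... | false | just w with endpoint-start-or-image f w
      ...   | inj₁ eq = inj₂ (v , trans eg (cong just (sym eq)))
      ...   | inj₂ p = inj₂ p

      next∈trajectory : ∀ f v {y z} → y ∈ trajectory f v → y ≢ endpoint f v → g y ≡ just z
                      → z ∈ trajectory f v
      next∈trajectory zero v (here refl) ne gy = ⊥-elim (ne refl)
      next∈trajectory (suc f) v m ne gy with stop v | g v in eg
      next∈trajectory (suc f) v (here refl) ne gy | true | _ = ⊥-elim (ne refl)
      next∈trajectory (suc f) v (here refl) ne gy | false | nothing = ⊥-elim (ne refl)
      next∈trajectory (suc f) v (here refl) ne gy | false | just w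
        with just-injective (trans (sym eg) gy)
      ... | refl = there (here refl)
      next∈trajectory (suc f) v (there m) ne gy | false | just w = there (next∈trajectory f w m ne gy)

      start-has-next : ∀ f v {x} → x ∈ trajectory f v → x ≢ v → ∃[ w ] (g v ≡ just w)
      start-has-next zero v (here refl) ne = ⊥-elim (ne refl)
      start-has-next (suc f) v m ne with stop v | g v
      start-has-next (suc f) v (here refl) ne | _ | _ = ⊥-elim (ne refl)
      start-has-next (suc f) v (there ()) ne | true | _
      start-has-next (suc f) v (there ()) ne | false | nothing
      start-has-next (suc f) v (there m) ne | false | just w = w , refl

    never : V → Bool
    never _ = false

    open Until never public using () renaming (trajectory to orbit)

    orbit-extend : ∀ f z {x w} → x ∈ orbit f z → g x ≡ just w → w ∈ orbit (suc f) z
    orbit-extend zero z (here refl) gx rewrite gx = there (here refl)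
    orbit-extend (suc f) z m gx with g z in eg
    orbit-extend (suc f) z (here refl) gx | nothing with trans (sym eg) gx
    ... | ()
    orbit-extend (suc f) z (here refl) gx | just z' with just-injective (trans (sym eg) gx)
    ... | refl = there (here refl)
    orbit-extend (suc f) z (there m) gx | just z' = there (orbit-extend f z' m gx)

    stopAt : V → V → Bool
    stopAt x y = does (y ≟ x)

    stopAt-self : ∀ u → stopAt u u ≡ true
    stopAt-self u with u ≟ u
    ... | yes _ = refl
    ... | no ne = ⊥-elim (ne refl)

    stopAt-true : ∀ {u x} → stopAt u x ≡ true → x ≡ u
    stopAt-true {u} {x} e with x ≟ u
    ... | yes eq = eq
    stopAt-true {u} {x} () | no _

    stopAt-false : ∀ {u x} → stopAt u x ≡ false → x ≢ u
    stopAt-false {u} {x} e eq with x ≟ u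
    stopAt-false {u} {x} () eq | yes _
    ... | no ne = ne eq

    orbit-stopAt : ∀ f w {x} → x ∈ orbit f w → x ∈ Until.trajectory (stopAt x) f w
    orbit-stopAt zero w (here refl) = here refl
    orbit-stopAt (suc f) w {x} m with w ≟ x
    orbit-stopAt (suc f) w {x} (here refl) | _ = here refl
    orbit-stopAt (suc f) w {x} (there m) | yes refl = here refl
    orbit-stopAt (suc f) w {x} (there m) | no _ with g w
    orbit-stopAt (suc f) w {x} (there m) | no _ | just w' = there (orbit-stopAt f w' m)

  module Reverse {V : Set} (_≟_ : DecidableEquality V) (g h : V → Maybe V)
                 (adj : ∀ {x y} → h y ≡ just x → g x ≡ just y) where
    module G = Iterate _≟_ g
    module H = Iterate _≟_ h

    reverse-orbit : ∀ f u {z} → z ∈ H.orbit f u → u ∈ G.orbit f z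
    reverse-orbit zero u (here refl) = here refl
    reverse-orbit (suc f) u m with h u in eh
    reverse-orbit (suc f) u (here refl) | _ = here refl
    reverse-orbit (suc f) u (there m) | just y = G.orbit-extend f _ (reverse-orbit f y m) (adj eh)

module Finiteness where

  open import Data.Nat using (ℕ; _+_; _≤_)
  open import Data.Fin using (Fin; join; splitAt)
  import Data.Fin as Fin
  open import Data.Fin.Properties using (injective⇒≤; splitAt-join)
  open import Data.List using (List; length; map; allFin)
  open import Data.List.Relation.Unary.Unique.Propositional using (Unique)
  open import Data.List.Membership.Propositional using (_∈_)
  open import Data.List.Membership.Propositional.Properties using (∈-map⁺; ∈-allFin)
  open import Data.Sum using (_⊎_; inj₁; inj₂)
  import Data.Sum as Sum
  open import Relation.Nullary using (yes; no)
  open import Relation.Binary.Definitions using (DecidableEquality)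
  open import Relation.Binary.PropositionalEquality using (_≡_; refl; sym; trans; cong; subst)
  open ListFacts using (lookup-injective)

  record FiniteType (V : Set) : Set where
    field
      size          : ℕ
      encode        : V → Fin size
      decode        : Fin size → V
      decode-encode : ∀ v → decode (encode v) ≡ v

    encode-injective : ∀ {u v} → encode u ≡ encode v → u ≡ v
    encode-injective {u} {v} eq = trans (sym (decode-encode u)) (trans (cong decode eq) (decode-encode v))

    _≟_ : DecidableEquality V
    u ≟ v with encode u Fin.≟ encode v
    ... | yes eq = yes (encode-injective eq)
    ... | no ne = no (λ eq → ne (cong encode eq))

    unique-length≤size : ∀ {xs} → Unique xs → length xs ≤ size
    unique-length≤size u = injective⇒≤ (λ eq → lookup-injective u _ _ (encode-injective eq))

    enumeration : List V
    enumeration = map decode (allFin size)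

    ∈-enumeration : ∀ v → v ∈ enumeration
    ∈-enumeration v = subst (_∈ enumeration) (decode-encode v) (∈-map⁺ decode (∈-allFin (encode v)))

  open FiniteType

  Fin-finite : ∀ m → FiniteType (Fin m)
  Fin-finite m = record { size = m ; encode = λ i → i ; decode = λ i → i ; decode-encode = λ _ → refl }

  ⊎-finite : ∀ {A B : Set} → FiniteType A → FiniteType B → FiniteType (A ⊎ B)
  ⊎-finite FA FB = record
    { size = size FA + size FB
    ; encode = λ x → join (size FA) (size FB) (Sum.map (encode FA) (encode FB) x)
    ; decode = λ i → Sum.map (decode FA) (decode FB) (splitAt (size FA) i)
    ; decode-encode = λ x → trans (cong (Sum.map (decode FA) (decode FB)) (splitAt-join (size FA) (size FB) (Sum.map (encode FA) (encode FB) x)))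
                                  (back x)
    }
    where
    back : ∀ x → Sum.map (decode FA) (decode FB) (Sum.map (encode FA) (encode FB) x) ≡ x
    back (inj₁ a) = cong inj₁ (decode-encode FA a)
    back (inj₂ b) = cong inj₂ (decode-encode FB b)

  retract : ∀ {V W : Set} → FiniteType W → (f : V → W) (g : W → V) → (∀ v → g (f v) ≡ v) → FiniteType V
  retract FW f g gf = record
    { size = size FW
    ; encode = λ v → encode FW (f v)
    ; decode = λ i → g (decode FW i)
    ; decode-encode = λ v → trans (cong g (decode-encode FW (f v))) (gf v)
    }

module Arrows where

  open import Defs
  open import Data.Nat using (ℕ; zero; suc; _≤_; _≤?_)
  open import Data.Nat.Properties using (≤-trans; ≤-refl; ≤-antisym; n≮n; <⇒≤; ≰⇒>)
  open import Data.Bool using (Bool; true; false)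
  open import Data.Maybe using (Maybe; just; nothing)
  import Data.Maybe as Maybe
  open import Data.Maybe.Properties using (just-injective; map-just)
  open import Data.Fin using (Fin; toℕ)
  import Data.Fin as Fin
  open import Data.Fin.Properties using (toℕ-injective)
  open import Data.List using (List; []; _∷_; length; map; filter; lookup; allFin; find)
  open import Data.List.Relation.Unary.All using (All; []; _∷_)
  import Data.List.Relation.Unary.All as All
  open import Data.List.Relation.Unary.All.Properties using (all-filter)
  open import Data.List.Relation.Unary.Any using (here; there)
  import Data.List.Relation.Unary.Any as Any
  open import Data.List.Relation.Unary.Any.Properties using (lookup-index)
  open import Data.List.Relation.Unary.Unique.Propositional using (Unique)
  import Data.List.Relation.Unary.Unique.Propositional.Properties as Unique
  open import Data.List.Membership.Propositional using (_∈_)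
  open import Data.List.Membership.Propositional.Properties using (∈-allFin; ∈-lookup; ∈-filter⁺)
  open import Data.Product using (∃-syntax; _×_; _,_; proj₁; proj₂)
  open import Data.Sum using (_⊎_; inj₁; inj₂)
  open import Data.Empty using (⊥-elim)
  open import Data.Unit using (tt)
  open import Relation.Nullary using (¬_; yes; no)
  open import Relation.Nullary.Decidable using (_×-dec_)
  open import Relation.Unary using (Decidable)
  open import Relation.Binary.PropositionalEquality using (_≡_; _≢_; refl; sym; trans; cong; subst)
  open ListFacts
  open Iteration
  open WalkFacts
  open Finiteness

  map≡just : ∀ {A B : Set} {f : A → B} (ms : Maybe A) {y}
           → Maybe.map f ms ≡ just y → ∃[ s ] (ms ≡ just s × f s ≡ y)
  map≡just (just s) refl = s , refl , refl

  module Decompose (G : Digraph) (fin : FiniteType (Digraph.Vtx G))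
    (allSteps : List (Step G)) (allSteps-complete : ∀ s → s ∈ allSteps)
    (Arr : Step G → Set) (Arr? : Decidable Arr)
    (arr-det : ∀ {e d d'} → Arr (e , d) → Arr (e , d') → d ≡ d')
    (arr-src-inj : ∀ {s1 s2} → Arr s1 → Arr s2 → stepSrc G s1 ≡ stepSrc G s2 → s1 ≡ s2)
    (arr-tgt-inj : ∀ {s1 s2} → Arr s1 → Arr s2 → stepTgt G s1 ≡ stepTgt G s2 → s1 ≡ s2)
    where

    open Digraph G
    open FiniteType fin renaming (_≟_ to _≟V_; size to M)
    open import Data.List.Membership.DecPropositional _≟V_ using (_∈?_)

    V : Set
    V = Vtx

    src tgt : Step G → V
    src = stepSrc G
    tgt = stepTgt G

    HasOut HasIn : V → Set
    HasOut v = ∃[ s ] (Arr s × src s ≡ v)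
    HasIn v = ∃[ s ] (Arr s × tgt s ≡ v)

    out inn : V → Maybe (Step G)
    out v = find (λ s → Arr? s ×-dec (src s ≟V v)) allSteps
    inn v = find (λ s → Arr? s ×-dec (tgt s ≟V v)) allSteps

    out-sound : ∀ {v s} → out v ≡ just s → Arr s × src s ≡ v
    out-sound {v} = find-sound (λ s → Arr? s ×-dec (src s ≟V v)) allSteps

    inn-sound : ∀ {v s} → inn v ≡ just s → Arr s × tgt s ≡ v
    inn-sound {v} = find-sound (λ s → Arr? s ×-dec (tgt s ≟V v)) allSteps

    out-complete : ∀ {s} → Arr s → out (src s) ≡ just s
    out-complete {s} a
      with find-complete (λ s' → Arr? s' ×-dec (src s' ≟V src s)) allSteps (a , refl) (allSteps-complete s)
    ... | _ , eq with out-sound eq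
    ...   | a' , same-src with arr-src-inj a' a same-src
    ...     | refl = eq

    inn-complete : ∀ {s} → Arr s → inn (tgt s) ≡ just s
    inn-complete {s} a
      with find-complete (λ s' → Arr? s' ×-dec (tgt s' ≟V tgt s)) allSteps (a , refl) (allSteps-complete s)
    ... | _ , eq with inn-sound eq
    ...   | a' , same-tgt with arr-tgt-inj a' a same-tgt
    ...     | refl = eq

    out-nothing⇒¬HasOut : ∀ {v} → out v ≡ nothing → ¬ HasOut v
    out-nothing⇒¬HasOut e (s , a , refl) with trans (sym e) (out-complete a)
    ... | ()

    inn-nothing⇒¬HasIn : ∀ {v} → inn v ≡ nothing → ¬ HasIn v
    inn-nothing⇒¬HasIn e (s , a , refl) with trans (sym e) (inn-complete a)
    ... | ()

    ¬HasIn⇒inn-nothing : ∀ v → ¬ HasIn v → inn v ≡ nothing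
    ¬HasIn⇒inn-nothing v nh with inn v in eq
    ... | nothing = refl
    ... | just s = ⊥-elim (nh (s , inn-sound eq))

    nxt prv : V → Maybe V
    nxt v = Maybe.map tgt (out v)
    prv v = Maybe.map src (inn v)

    nxt-just : ∀ {x s} → out x ≡ just s → nxt x ≡ just (tgt s)
    nxt-just = map-just

    out-defined : ∀ x → nxt x ≢ nothing → ∃[ s ] (out x ≡ just s)
    out-defined x ne with out x
    ... | just s = s , refl
    ... | nothing = ⊥-elim (ne refl)

    out-undefined : ∀ x → nxt x ≡ nothing → out x ≡ nothing
    out-undefined x e with out x
    ... | nothing = refl

    prv-undefined : ∀ {z} → inn z ≡ nothing → prv z ≡ nothing
    prv-undefined e rewrite e = refl

    inn-undefined : ∀ z → prv z ≡ nothing → inn z ≡ nothing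
    inn-undefined z e with inn z
    ... | nothing = refl

    prv⇒nxt : ∀ {x y} → prv y ≡ just x → nxt x ≡ just y
    prv⇒nxt {x} {y} e with map≡just (inn y) e
    ... | s , eq , refl with inn-sound eq
    ... | a , refl = nxt-just (out-complete a)

    nxt⇒prv : ∀ {x y} → nxt x ≡ just y → prv y ≡ just x
    nxt⇒prv {x} {y} e with map≡just (out x) e
    ... | s , eq , refl with out-sound eq
    ... | a , refl = map-just (inn-complete a)

    nxt-injective : ∀ {x x' y} → nxt x ≡ just y → nxt x' ≡ just y → x ≡ x'
    nxt-injective e e' = just-injective (trans (sym (nxt⇒prv e)) (nxt⇒prv e'))

    prv-injective : ∀ {x x' y} → prv x ≡ just y → prv x' ≡ just y → x ≡ x'
    prv-injective e e' = just-injective (trans (sym (prv⇒nxt e)) (prv⇒nxt e'))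

    module Fwd = Iterate _≟V_ nxt
    module Bwd = Iterate _≟V_ prv
    module FwdBwd = Reverse _≟V_ nxt prv prv⇒nxt
    module BwdFwd = Reverse _≟V_ prv nxt nxt⇒prv

    module FollowArrows (stop : V → Bool) where
      open Fwd.Until stop

      arrowSteps : ℕ → V → List (Step G)
      arrowStepsWith : ℕ → Bool → Maybe (Step G) → List (Step G)
      arrowSteps zero v = []
      arrowSteps (suc f) v = arrowStepsWith f (stop v) (out v)
      arrowStepsWith f true _ = []
      arrowStepsWith f false nothing = []
      arrowStepsWith f false (just s) = s ∷ arrowSteps f (tgt s)

      arrowSteps-valid : ∀ f v → ValidFrom G v (arrowSteps f v)
      arrowSteps-valid zero v = tt
      arrowSteps-valid (suc f) v with stop v | out v in eo
      ... | true | _ = tt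
      ... | false | nothing = tt
      ... | false | just s = proj₂ (out-sound eo) , arrowSteps-valid f (tgt s)

      arrowSteps-verts : ∀ f v → vertsFrom G v (arrowSteps f v) ≡ trajectory f v
      arrowSteps-verts zero v = refl
      arrowSteps-verts (suc f) v with stop v | out v
      ... | true | _ = refl
      ... | false | nothing = refl
      ... | false | just s = cong (v ∷_) (arrowSteps-verts f (tgt s))

      arrowSteps-end : ∀ f v → endFrom G v (arrowSteps f v) ≡ endpoint f v
      arrowSteps-end zero v = refl
      arrowSteps-end (suc f) v with stop v | out v
      ... | true | _ = refl
      ... | false | nothing = refl
      ... | false | just s = arrowSteps-end f (tgt s)

      arrowSteps-arrows : ∀ f v → All Arr (arrowSteps f v)
      arrowSteps-arrows zero v = []
      arrowSteps-arrows (suc f) v with stop v | out v in eo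
      ... | true | _ = []
      ... | false | nothing = []
      ... | false | just s = proj₁ (out-sound eo) ∷ arrowSteps-arrows f (tgt s)

    out-step∈walk : ∀ {v ss x sx} → ValidFrom G v ss → All Arr ss → x ∈ vertsFrom G v ss
                  → out x ≡ just sx → x ≢ endFrom G v ss → sx ∈ ss
    out-step∈walk ok as m ox ne with vertex-end-or-src G ok m
    ... | inj₁ eq = ⊥-elim (ne eq)
    ... | inj₂ (s' , m' , refl) with trans (sym ox) (out-complete (All.lookup as m'))
    ... | refl = m'

    -- Paths: from a vertex z without incoming arrow, follow arrows; since
    -- nothing returns to z and nxt is injective, no vertex repeats, so by
    -- pigeonhole the walk stops (at a vertex without outgoing arrow)
    -- within `size` steps.
    module Path = FollowArrows Fwd.never

    pathFrom : V → Walk G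
    pathFrom z = walk z (Path.arrowSteps M z) (Path.arrowSteps-valid M z)

    pathEnd : V → V
    pathEnd z = Fwd.Until.endpoint Fwd.never M z

    no-nxt-into : ∀ {z y} → inn z ≡ nothing → nxt y ≢ just z
    no-nxt-into {z} e ny with nxt⇒prv ny
    ... | q rewrite e with q
    ... | ()

    path-unique : ∀ z → inn z ≡ nothing → Unique (Fwd.orbit M z)
    path-unique z e with Fwd.Until.unique-or-returns Fwd.never nxt-injective M z
    ... | inj₁ u = u
    ... | inj₂ (y , _ , _ , gy) = ⊥-elim (no-nxt-into e gy)

    path-terminates : ∀ z → inn z ≡ nothing → nxt (pathEnd z) ≡ nothing
    path-terminates z e with Fwd.Until.full-or-terminated Fwd.never M z
    ... | inj₁ len = ⊥-elim (n≮n M (subst (_≤ M) len (unique-length≤size (path-unique z e))))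
    ... | inj₂ (inj₁ ())
    ... | inj₂ (inj₂ t) = t

    out-step∈path : ∀ z {u s} → inn z ≡ nothing → u ∈ Fwd.orbit M z → out u ≡ just s
                  → s ∈ steps (pathFrom z)
    out-step∈path z {u} {s} e m eo =
      out-step∈walk (Path.arrowSteps-valid M z) (Path.arrowSteps-arrows M z)
        (subst (u ∈_) (sym (Path.arrowSteps-verts M z)) m) eo not-end
      where
      not-end : u ≢ endFrom G z (Path.arrowSteps M z)
      not-end eq with trans (sym (nxt-just eo))
                       (subst (λ w → nxt w ≡ nothing) (sym (trans eq (Path.arrowSteps-end M z)))
                              (path-terminates z e))
      ... | ()

    -- Cycles: loopVia u s lists the vertices reached from u by the arrow s
    -- and further arrows, stopping on return to u; u lies on a cycle iff
    -- this loop returns.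
    loopVia : V → Step G → List V
    loopVia u s = Fwd.Until.trajectory (Fwd.stopAt u) M (tgt s)

    loopWith : V → Maybe (Step G) → List V
    loopWith u nothing = []
    loopWith u (just s) = loopVia u s

    loop : V → List V
    loop u = loopWith u (out u)

    OnCycle : V → Set
    OnCycle u = u ∈ loop u

    OnCycleVia : V → Set
    OnCycleVia u = ∃[ s ] (out u ≡ just s × u ∈ loopVia u s)

    onCycle-via : ∀ {u} → OnCycle u → OnCycleVia u
    onCycle-via {u} c = go (out u) refl c
      where
      go : ∀ ms → out u ≡ ms → u ∈ loopWith u ms → OnCycleVia u
      go (just s) eq c' = s , eq , c'

    loop≡loopVia : ∀ {u s} → out u ≡ just s → loop u ≡ loopVia u s
    loop≡loopVia {u} e rewrite e = refl

    via-onCycle : ∀ {u} → OnCycleVia u → OnCycle u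
    via-onCycle (s , eq , c) = subst (_ ∈_) (sym (loop≡loopVia eq)) c

    loopVia-unique : ∀ x sx → out x ≡ just sx → Unique (loopVia x sx)
    loopVia-unique x sx ex with Fwd.Until.unique-or-returns (Fwd.stopAt x) nxt-injective M (tgt sx)
    ... | inj₁ u = u
    ... | inj₂ (y , _ , sy , gy) = ⊥-elim (Fwd.stopAt-false sy (nxt-injective gy (nxt-just ex)))

    module OnLoop {u s} (eo : out u ≡ just s) (cu : u ∈ loopVia u s) where
      open Fwd.Until (Fwd.stopAt u)

      returns : endpoint M (tgt s) ≡ u
      returns = sym (stop-is-endpoint M (tgt s) cu (Fwd.stopAt-self u))

      nxt-defined : ∀ {x} → x ∈ loopVia u s → nxt x ≢ nothing
      nxt-defined m gn with dead-end-is-endpoint M (tgt s) m gn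
      ... | eq with trans (sym (nxt-just eo)) (subst (λ z → nxt z ≡ nothing) (trans eq returns) gn)
      ... | ()

      closed : ∀ {x y} → x ∈ loopVia u s → nxt x ≡ just y → y ∈ loopVia u s
      closed {x} m gy with x ≟V u
      ... | yes refl with just-injective (trans (sym (nxt-just eo)) gy)
      ...   | refl = here refl
      closed {x} m gy | no ne = next∈trajectory M (tgt s) m (λ eq → ne (trans eq returns)) gy

      members-onCycle : ∀ {x} → x ∈ loopVia u s → OnCycleVia x
      members-onCycle {x} m with out-defined x (nxt-defined m)
      ... | sx , ex with Fwd.Until.full-or-terminated (Fwd.stopAt x) M (tgt sx)
      ...   | inj₁ len = ⊥-elim (n≮n M (subst (_≤ M) len (unique-length≤size (loopVia-unique x sx ex))))
      ...   | inj₂ (inj₁ st) = sx , ex ,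
                subst (_∈ loopVia x sx) (Fwd.stopAt-true st) (Fwd.Until.endpoint∈ (Fwd.stopAt x) M (tgt sx))
      ...   | inj₂ (inj₂ gn) = ⊥-elim (nxt-defined lastIn gn)
        where
        lastIn : Fwd.Until.endpoint (Fwd.stopAt x) M (tgt sx) ∈ loopVia u s
        lastIn = Fwd.Until.endpoint-closed (Fwd.stopAt x) (_∈ loopVia u s) closed M (tgt sx)
                   (here refl) (closed m (nxt-just ex))

      sub-loop : ∀ {x sx} → x ∈ loopVia u s → out x ≡ just sx
               → ∀ {y} → y ∈ loopVia x sx → y ∈ loopVia u s
      sub-loop {x} {sx} m ex =
        All.lookup (Fwd.Until.all-closed (Fwd.stopAt x) (_∈ loopVia u s) closed M (tgt sx)
                      (closed m (nxt-just ex)))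

    loop-shared : ∀ {u s x sx} (eo : out u ≡ just s) (cu : u ∈ loopVia u s) → x ∈ loopVia u s
                → (ex : out x ≡ just sx) (cx : x ∈ loopVia x sx)
                → ∀ {y} → y ∈ loopVia u s → y ∈ loopVia x sx
    loop-shared {u} {s} {x} {sx} eo cu m ex cx =
      All.lookup (Fwd.Until.all-closed (Fwd.stopAt u) (_∈ loopVia x sx) (OnLoop.closed ex cx) M (tgt s)
                    (OnLoop.closed ex cx u∈ (nxt-just eo)))
      where
      u∈ : u ∈ loopVia x sx
      u∈ = subst (_∈ loopVia x sx) (OnLoop.returns eo cu)
             (Fwd.Until.endpoint-closed (Fwd.stopAt u) (_∈ loopVia x sx) (OnLoop.closed ex cx) M (tgt s) m cx)

    loop-onCycle : ∀ {u x} → OnCycle u → x ∈ loop u → OnCycle x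
    loop-onCycle c m with onCycle-via c
    ... | s , eo , cu = via-onCycle (OnLoop.members-onCycle eo cu (subst (_ ∈_) (loop≡loopVia eo) m))

    loop-trans : ∀ {u x y} → OnCycle u → x ∈ loop u → y ∈ loop x → y ∈ loop u
    loop-trans c m my with onCycle-via c | onCycle-via (loop-onCycle c m)
    ... | s , eo , cu | sx , ex , cx =
      subst (_ ∈_) (sym (loop≡loopVia eo))
        (OnLoop.sub-loop eo cu (subst (_ ∈_) (loop≡loopVia eo) m) ex (subst (_ ∈_) (loop≡loopVia ex) my))

    loop-sym : ∀ {u x y} → OnCycle u → x ∈ loop u → y ∈ loop u → y ∈ loop x
    loop-sym c m my with onCycle-via c | onCycle-via (loop-onCycle c m)
    ... | s , eo , cu | sx , ex , cx =
      subst (_ ∈_) (sym (loop≡loopVia ex))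
        (loop-shared eo cu (subst (_ ∈_) (loop≡loopVia eo) m) ex cx (subst (_ ∈_) (loop≡loopVia eo) my))

    loop-nxt-defined : ∀ {u x} → OnCycle u → x ∈ loop u → nxt x ≢ nothing
    loop-nxt-defined c m with onCycle-via c
    ... | s , eo , cu = OnLoop.nxt-defined eo cu (subst (_ ∈_) (loop≡loopVia eo) m)

    loop-closed : ∀ {u x y} → OnCycle u → x ∈ loop u → nxt x ≡ just y → y ∈ loop u
    loop-closed c m gy with onCycle-via c
    ... | s , eo , cu =
      subst (_ ∈_) (sym (loop≡loopVia eo)) (OnLoop.closed eo cu (subst (_ ∈_) (loop≡loopVia eo) m) gy)

    circuitSteps : V → Maybe (Step G) → List (Step G)
    circuitSteps u nothing = []
    circuitSteps u (just s) = s ∷ FollowArrows.arrowSteps (Fwd.stopAt u) M (tgt s)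

    circuitValid : ∀ u ms → out u ≡ ms → ValidFrom G u (circuitSteps u ms)
    circuitValid u nothing _ = tt
    circuitValid u (just s) eo = proj₂ (out-sound eo) , FollowArrows.arrowSteps-valid (Fwd.stopAt u) M (tgt s)

    circuitWith : ∀ u ms → out u ≡ ms → Walk G
    circuitWith u ms eq = walk u (circuitSteps u ms) (circuitValid u ms eq)

    circuit : V → Walk G
    circuit u = circuitWith u (out u) refl

    module CircuitOf {u s} (eo : out u ≡ just s) (cu : u ∈ loopVia u s) where
      module T = FollowArrows (Fwd.stopAt u)

      ss : List (Step G)
      ss = T.arrowSteps M (tgt s)

      verts≡loop : vertsFrom G (tgt s) ss ≡ loopVia u s
      verts≡loop = T.arrowSteps-verts M (tgt s)

      ends-at-u : endFrom G (tgt s) ss ≡ u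
      ends-at-u = trans (T.arrowSteps-end M (tgt s)) (OnLoop.returns eo cu)

      arrows : All Arr (s ∷ ss)
      arrows = proj₁ (out-sound eo) ∷ T.arrowSteps-arrows M (tgt s)

      is-circuit : IsCircuit G (circuitWith u (just s) eo)
      is-circuit = (λ ()) , ends-at-u , distinct-verts , distinct-targets⇒distinct-edges G Arr arr-det arrows distinct-tgts
        where
        distinct-verts : Unique (vertsFrom G (tgt s) ss)
        distinct-verts = subst Unique (sym verts≡loop) (loopVia-unique u s eo)
        distinct-tgts : Unique (map tgt (s ∷ ss))
        distinct-tgts = subst Unique (verts-targets G (T.arrowSteps-valid M (tgt s))) distinct-verts

      verts⊆loop : ∀ {x} → x ∈ vertsFrom G u (s ∷ ss) → x ∈ loopVia u s
      verts⊆loop (here refl) = cu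
      verts⊆loop (there m) = subst (_ ∈_) verts≡loop m

      out-step∈circuit : ∀ {x sx} → x ∈ loopVia u s → out x ≡ just sx → sx ∈ s ∷ ss
      out-step∈circuit {x} {sx} m ex with x ≟V u
      ... | yes refl with trans (sym eo) ex
      ...   | refl = here refl
      out-step∈circuit {x} {sx} m ex | no ne =
        out-step∈walk (circuitValid u (just s) eo) arrows (there (subst (_ ∈_) (sym verts≡loop) m)) ex
          (λ eq → ne (trans eq ends-at-u))

    circuit-elim : ∀ {u} (Q : Walk G → Set)
                 → (∀ {s} (eo : out u ≡ just s) (cu : u ∈ loopVia u s) → Q (circuitWith u (just s) eo))
                 → OnCycle u → Q (circuit u)
    circuit-elim {u} Q h c = go (out u) refl (onCycle-via c)
      where
      go : ∀ ms (eq : out u ≡ ms) → OnCycleVia u → Q (circuitWith u ms eq)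
      go nothing eq (s , eo , cu) with trans (sym eq) eo
      ... | ()
      go (just s') eq (s , eo , cu) with trans (sym eq) eo
      ... | refl = h eq cu

    -- Each cycle is listed once, through its vertex of least code.
    minimum-by : ∀ (key : V → ℕ) (xs : List V) → xs ≢ []
               → ∃[ m ] (m ∈ xs × All (λ x → key m ≤ key x) xs)
    minimum-by key [] ne = ⊥-elim (ne refl)
    minimum-by key (x ∷ []) ne = x , here refl , ≤-refl ∷ []
    minimum-by key (x ∷ y ∷ ys) ne with minimum-by key (y ∷ ys) (λ ())
    ... | m , mm , am with key x ≤? key m
    ...   | yes le = x , here refl , ≤-refl ∷ All.map (≤-trans le) am
    ...   | no nle = m , there mm , <⇒≤ (≰⇒> nle) ∷ am

    key : V → ℕ
    key x = toℕ (encode x)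

    IsRep : Fin M → Set
    IsRep i = OnCycle (decode i) × encode (decode i) ≡ i × All (λ x → toℕ i ≤ key x) (loop (decode i))

    isRep? : Decidable IsRep
    isRep? i = (decode i ∈? loop (decode i))
               ×-dec ((encode (decode i) Fin.≟ i) ×-dec All.all? (λ x → toℕ i ≤? key x) (loop (decode i)))

    reps : List (Fin M)
    reps = filter isRep? (allFin M)

    reps-unique : Unique reps
    reps-unique = Unique.filter⁺ isRep? (Unique.allFin⁺ M)

    d : ℕ
    d = length reps

    repOf : Fin d → V
    repOf k = decode (lookup reps k)

    rep-ok : ∀ k → IsRep (lookup reps k)
    rep-ok k = All.lookup (all-filter isRep? (allFin M)) (∈-lookup k)

    C : Fin d → Walk G
    C k = circuit (repOf k)

    C-circ : ∀ k → IsCircuit G (C k)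
    C-circ k = circuit-elim (IsCircuit G) CircuitOf.is-circuit (proj₁ (rep-ok k))

    C-arr : ∀ k → All Arr (steps (C k))
    C-arr k = circuit-elim (λ w → All Arr (steps w)) CircuitOf.arrows (proj₁ (rep-ok k))

    C-vin : ∀ k {x} → x ∈ verts G (C k) → x ∈ loop (repOf k)
    C-vin k {x} = circuit-elim (λ w → x ∈ verts G w → x ∈ loop (repOf k))
                    (λ eo cu m → subst (x ∈_) (sym (loop≡loopVia eo)) (CircuitOf.verts⊆loop eo cu m))
                    (proj₁ (rep-ok k))

    rep-least : ∀ k {x} → x ∈ loop (repOf k) → toℕ (lookup reps k) ≤ key x
    rep-least k = All.lookup (proj₂ (proj₂ (rep-ok k)))

    rep-key : ∀ k → key (repOf k) ≡ toℕ (lookup reps k)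
    rep-key k = cong toℕ (proj₁ (proj₂ (rep-ok k)))

    -- circuits through a common vertex have each other's representative on
    -- their loop, so by minimality the representatives coincide
    disjCC : ∀ k l → k ≢ l → VDisjoint G (C k) (C l)
    disjCC k l ne x mk ml =
      ne (lookup-injective reps-unique k l (toℕ-injective (≤-antisym (below k l mk ml) (below l k ml mk))))
      where
      below : ∀ k l → x ∈ verts G (C k) → x ∈ verts G (C l) → toℕ (lookup reps k) ≤ toℕ (lookup reps l)
      below k l mk ml =
        subst (toℕ (lookup reps k) ≤_) (rep-key l)
          (rep-least k (loop-trans (proj₁ (rep-ok k)) (C-vin k mk)
                                   (loop-sym (proj₁ (rep-ok l)) (C-vin l ml) (proj₁ (rep-ok l)))))

    representative : ∀ {u} → OnCycle u → ∃[ k ] (u ∈ loop (repOf k))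
    representative {u} c = k , subst (λ z → u ∈ loop (decode z)) k-rep u∈
      where
      loop-nonempty : loop u ≢ []
      loop-nonempty eq with subst (u ∈_) eq c
      ... | ()
      least : ∃[ m ] (m ∈ loop u × All (λ x → key m ≤ key x) (loop u))
      least = minimum-by key (loop u) loop-nonempty
      m : V
      m = proj₁ least
      m∈ : m ∈ loop u
      m∈ = proj₁ (proj₂ least)
      i : Fin M
      i = encode m
      rep : IsRep i
      rep = subst OnCycle (sym (decode-encode m)) (loop-onCycle c m∈)
          , cong encode (decode-encode m)
          , subst (λ z → All (λ x → toℕ i ≤ key x) (loop z)) (sym (decode-encode m))
                  (All.tabulate (λ mx → All.lookup (proj₂ (proj₂ least)) (loop-trans c m∈ mx)))
      i∈reps : i ∈ reps
      i∈reps = ∈-filter⁺ isRep? (∈-allFin i) rep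
      k : Fin d
      k = Any.index i∈reps
      k-rep : i ≡ lookup reps k
      k-rep = lookup-index i∈reps
      u∈ : u ∈ loop (decode i)
      u∈ = subst (λ z → u ∈ loop z) (sym (decode-encode m)) (loop-sym c m∈ c)

    cover-cyclic : ∀ {u s} → OnCycle u → out u ≡ just s → ∃[ k ] (s ∈ steps (C k))
    cover-cyclic {u} {s} c eo =
      k , circuit-elim (λ w → s ∈ steps w)
            (λ eo' cu → CircuitOf.out-step∈circuit eo' cu (subst (u ∈_) (loop≡loopVia eo') u∈) eo)
            (proj₁ (rep-ok k))
      where
      rep : ∃[ k ] (u ∈ loop (repOf k))
      rep = representative c
      k : Fin d
      k = proj₁ rep
      u∈ : u ∈ loop (repOf k)
      u∈ = proj₂ rep

    module Paths (p : ℕ) (starts : Fin p → V)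
      (starts-noIn : ∀ k → ¬ HasIn (starts k))
      (starts-injective : ∀ k l → starts k ≡ starts l → k ≡ l)
      (starts-cover : ∀ v → HasOut v → ¬ HasIn v → ∃[ k ] (starts k ≡ v)) where

      inn-starts : ∀ k → inn (starts k) ≡ nothing
      inn-starts k = ¬HasIn⇒inn-nothing _ (starts-noIn k)

      P : Fin p → Walk G
      P k = pathFrom (starts k)

      P-simple : ∀ k → IsSimplePath G (P k)
      P-simple k = subst Unique (sym (Path.arrowSteps-verts M (starts k))) (path-unique (starts k) (inn-starts k))

      P-arr : ∀ k → All Arr (steps (P k))
      P-arr k = Path.arrowSteps-arrows M (starts k)

      P-finish : ∀ k → finish G (P k) ≡ pathEnd (starts k)
      P-finish k = Path.arrowSteps-end M (starts k)

      P-end : ∀ k → HasOut (starts k) → HasIn (finish G (P k)) × ¬ HasOut (finish G (P k))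
      P-end k (s , a , src≡) = has-in , out-nothing⇒¬HasOut no-out
        where
        terminated : nxt (pathEnd (starts k)) ≡ nothing
        terminated = path-terminates (starts k) (inn-starts k)
        leaves-start : nxt (starts k) ≡ just (tgt s)
        leaves-start = nxt-just (subst (λ v → out v ≡ just s) src≡ (out-complete a))
        no-out : out (finish G (P k)) ≡ nothing
        no-out = subst (λ z → out z ≡ nothing) (sym (P-finish k)) (out-undefined _ terminated)
        has-in : HasIn (finish G (P k))
        has-in with Fwd.Until.endpoint-start-or-image Fwd.never M (starts k)
        ... | inj₁ eq with trans (sym leaves-start) (subst (λ z → nxt z ≡ nothing) eq terminated)
        ...   | ()
        has-in | inj₂ (y , gy) with map≡just (inn (pathEnd (starts k))) (nxt⇒prv gy)
        ...   | s' , e' , _ = s' , inn-sound (subst (λ z → inn z ≡ just s') (sym (P-finish k)) e')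

      -- following arrows backwards from a common vertex reaches both starts
      disjPP : ∀ k l → k ≢ l → VDisjoint G (P k) (P l)
      disjPP k l ne x mk ml = ne (starts-injective k l (trans (back-to-start k mk) (sym (back-to-start l ml))))
        where
        back-to-start : ∀ k → x ∈ verts G (P k) → starts k ≡ Bwd.Until.endpoint Bwd.never M x
        back-to-start k m =
          Bwd.Until.dead-end-is-endpoint Bwd.never M x
            (BwdFwd.reverse-orbit M (starts k) (subst (x ∈_) (Path.arrowSteps-verts M (starts k)) m))
            (prv-undefined (inn-starts k))

      -- a path meeting a cycle would stay on it and never terminate
      disjCP : ∀ k l → VDisjoint G (C k) (P l)
      disjCP k l x mc mp = loop-nxt-defined ck end∈loop (path-terminates z (inn-starts l))
        where
        z : V
        z = starts l
        ck : OnCycle (repOf k)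
        ck = proj₁ (rep-ok k)
        end∈loop : pathEnd z ∈ loop (repOf k)
        end∈loop = Fwd.Until.endpoint-closed Fwd.never (_∈ loop (repOf k)) (loop-closed ck) M z
                     (subst (x ∈_) (Path.arrowSteps-verts M z) mp) (C-vin k mc)

      cover-from-start : ∀ {s} → Arr s → ∀ z → prv z ≡ nothing → src s ∈ Fwd.orbit M z
                       → ∃[ k ] (s ∈ steps (P k))
      cover-from-start {s} a z pn uz with starts-cover z z-has-out (inn-nothing⇒¬HasIn (inn-undefined z pn))
        where
        z-has-out : HasOut z
        z-has-out with z ≟V src s
        ... | yes refl = s , a , refl
        ... | no ne with Fwd.Until.start-has-next Fwd.never M z uz (λ eq → ne (sym eq))
        ...   | w , gw with map≡just (out z) gw
        ...     | sz , ez , _ = sz , out-sound ez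
      ... | k , refl = k , out-step∈path z (inn-undefined z pn) uz (out-complete a)

      -- an arrow off all cycles: walking backwards from its source reaches
      -- a vertex without incoming arrow
      cover-acyclic : ∀ {s} → Arr s → ¬ OnCycle (src s) → ∃[ k ] (s ∈ steps (P k))
      cover-acyclic {s} a nc with Bwd.Until.unique-or-returns Bwd.never prv-injective M (src s)
      ... | inj₂ (y , m , _ , gy) = ⊥-elim (nc (via-onCycle (s , out-complete a , returns)))
        where
        y≡tgt : y ≡ tgt s
        y≡tgt = just-injective (trans (sym (prv⇒nxt gy)) (nxt-just (out-complete a)))
        returns : src s ∈ loopVia (src s) s
        returns = subst (λ w → src s ∈ Fwd.Until.trajectory (Fwd.stopAt (src s)) M w) y≡tgt
                    (Fwd.orbit-stopAt M y (FwdBwd.reverse-orbit M (src s) m))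
      ... | inj₁ uq with Bwd.Until.full-or-terminated Bwd.never M (src s)
      ...   | inj₁ len = ⊥-elim (n≮n M (subst (_≤ M) len (unique-length≤size uq)))
      ...   | inj₂ (inj₁ ())
      ...   | inj₂ (inj₂ pn) =
        cover-from-start a _ pn (FwdBwd.reverse-orbit M (src s) (Bwd.Until.endpoint∈ Bwd.never M (src s)))

      cover : ∀ {s} → Arr s → (∃[ k ] (s ∈ steps (C k))) ⊎ (∃[ k ] (s ∈ steps (P k)))
      cover {s} a with src s ∈? loop (src s)
      ... | yes c = inj₁ (cover-cyclic c (out-complete a))
      ... | no nc = inj₂ (cover-acyclic a nc)

module SubsetFacts where

  open import Defs
  open import Data.Nat using (ℕ; _+_; _≤_; _<_)
  import Data.Nat as Nat
  open import Data.Nat.Properties using (≤-antisym; ≤-refl)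
  open import Data.Bool using (true; false)
  open import Data.Fin using (Fin; zero; suc; _≟_)
  open import Data.Fin.Properties using (suc-injective; any?)
  open import Data.Fin.Subset using (Subset; _∈_; _∪_; ∣_∣)
  open import Data.Fin.Subset.Properties using (_∈?_; x∈p∪q⁻; x∈p∪q⁺)
  open import Data.Vec using ([]; _∷_; here; there)
  open import Data.Vec.Properties using (lookup∘tabulate; []=⇒lookup; lookup⇒[]=)
  open import Data.List using (List; []; _∷_; length; map; _++_; allFin; upTo)
  open import Data.List.Properties using (length-map; length-++; length-tabulate; length-upTo)
  import Data.List.Relation.Unary.All as All
  import Data.List.Relation.Unary.Any as Any
  open import Data.List.Relation.Unary.AllPairs using ([]; _∷_)
  open import Data.List.Relation.Unary.Unique.Propositional using (Unique)
  import Data.List.Relation.Unary.Unique.Propositional.Properties as Unique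
  open import Data.List.Membership.Propositional using () renaming (_∈_ to _∈ₗ_)
  open import Data.List.Membership.Propositional.Properties using (∈-map⁺; ∈-map⁻; ∈-++⁺ˡ; ∈-++⁺ʳ; ∈-++⁻; ∈-upTo⁺)
  open import Data.Product using (∃-syntax; _×_; _,_)
  open import Data.Sum using (inj₁; inj₂)
  open import Data.Empty using (⊥; ⊥-elim)
  open import Relation.Nullary using (yes; no; does)
  open import Relation.Nullary.Decidable using (_×-dec_)
  open import Relation.Binary.PropositionalEquality using (_≡_; _≢_; refl; sym; trans; cong; cong₂; subst₂)
  open ListFacts

  members : ∀ {n} → Subset n → List (Fin n)
  members [] = []
  members (true ∷ S) = zero ∷ map suc (members S)
  members (false ∷ S) = map suc (members S)

  members-length : ∀ {n} (S : Subset n) → length (members S) ≡ ∣ S ∣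
  members-length [] = refl
  members-length (true ∷ S) = cong Nat.suc (trans (length-map suc (members S)) (members-length S))
  members-length (false ∷ S) = trans (length-map suc (members S)) (members-length S)

  members⁻ : ∀ {n} {S : Subset n} {x} → x ∈ₗ members S → x ∈ S
  members⁻ {S = true ∷ S} (Any.here refl) = here
  members⁻ {S = true ∷ S} (Any.there m) with ∈-map⁻ suc m
  ... | y , m' , refl = there (members⁻ m')
  members⁻ {S = false ∷ S} m with ∈-map⁻ suc m
  ... | y , m' , refl = there (members⁻ m')

  members⁺ : ∀ {n} {S : Subset n} {x} → x ∈ S → x ∈ₗ members S
  members⁺ {S = true ∷ S} here = Any.here refl
  members⁺ {S = true ∷ S} (there m) = Any.there (∈-map⁺ suc (members⁺ m))
  members⁺ {S = false ∷ S} (there m) = ∈-map⁺ suc (members⁺ m)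

  members-unique : ∀ {n} (S : Subset n) → Unique (members S)
  members-unique [] = []
  members-unique (true ∷ S) = All.tabulate zero∉ ∷ Unique.map⁺ suc-injective (members-unique S)
    where
    zero∉ : ∀ {x} → x ∈ₗ map suc (members S) → zero ≢ x
    zero∉ m refl with ∈-map⁻ suc m
    ... | _ , _ , ()
  members-unique (false ∷ S) = Unique.map⁺ suc-injective (members-unique S)

  image⁻ : ∀ {m n} {f : Fin m → Fin n} {A : Subset m} {y} → y ∈ image f A → ∃[ i ] (i ∈ A × f i ≡ y)
  image⁻ {f = f} {A} {y} mem
    with any? (λ i → (i ∈? A) ×-dec (f i ≟ y))
       | trans (sym (lookup∘tabulate (λ y' → does (any? (λ i → (i ∈? A) ×-dec (f i ≟ y')))) y)) ([]=⇒lookup mem)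
  ... | yes w | _ = w
  ... | no _ | ()

  image⁺ : ∀ {m n} {f : Fin m → Fin n} {A : Subset m} {i} → i ∈ A → f i ∈ image f A
  image⁺ {f = f} {A} {i} i∈A =
    lookup⇒[]= (f i) (image f A) (trans (lookup∘tabulate (λ y' → does (any? (λ j → (j ∈? A) ×-dec (f j ≟ y')))) (f i)) found)
    where
    found : does (any? (λ j → (j ∈? A) ×-dec (f j ≟ f i))) ≡ true
    found with any? (λ j → (j ∈? A) ×-dec (f j ≟ f i))
    ... | yes _ = refl
    ... | no ne = ⊥-elim (ne (i , i∈A , refl))

  -- For injective γ whose image avoids X: ∣ X ∪ γ(B) ∣ = ∣ X ∣ + ∣ B ∣.
  -- Both sides count the duplicate-free list members X ++ map γ (members B).
  ∣X∪image∣ : ∀ {m n} (γ : Fin m → Fin n) → (∀ {i j} → γ i ≡ γ j → i ≡ j)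
            → (X : Subset n) → (∀ i → γ i ∈ X → ⊥)
            → ∀ (B : Subset m) → ∣ X ∪ image γ B ∣ ≡ ∣ X ∣ + ∣ B ∣
  ∣X∪image∣ {n = n} γ γ-inj X γ∉X B = ≤-antisym
    (subst₂ _≤_ (members-length (X ∪ image γ B)) length-L (unique-length-≤ (members-unique (X ∪ image γ B)) union⊆L))
    (subst₂ _≤_ length-L (members-length (X ∪ image γ B)) (unique-length-≤ L-unique L⊆union))
    where
    open Pigeonhole (_≟_ {n})
    L : List (Fin n)
    L = members X ++ map γ (members B)
    length-L : length L ≡ ∣ X ∣ + ∣ B ∣
    length-L = trans (length-++ (members X))
                     (cong₂ _+_ (members-length X) (trans (length-map γ (members B)) (members-length B)))
    L-unique : Unique L
    L-unique = Unique.++⁺ (members-unique X) (Unique.map⁺ γ-inj (members-unique B)) disjoint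
      where
      disjoint : ∀ {v} → v ∈ₗ members X × v ∈ₗ map γ (members B) → ⊥
      disjoint (m1 , m2) with ∈-map⁻ γ m2
      ... | i , _ , refl = γ∉X i (members⁻ {S = X} m1)
    L⊆union : ∀ {x} → x ∈ₗ L → x ∈ₗ members (X ∪ image γ B)
    L⊆union m with ∈-++⁻ (members X) m
    ... | inj₁ m1 = members⁺ (x∈p∪q⁺ {p = X} {q = image γ B} (inj₁ (members⁻ {S = X} m1)))
    ... | inj₂ m2 with ∈-map⁻ γ m2
    ...   | i , mi , refl = members⁺ (x∈p∪q⁺ {p = X} {q = image γ B} (inj₂ (image⁺ {f = γ} {A = B} (members⁻ {S = B} mi))))
    union⊆L : ∀ {x} → x ∈ₗ members (X ∪ image γ B) → x ∈ₗ L
    union⊆L m with x∈p∪q⁻ X (image γ B) (members⁻ {S = X ∪ image γ B} m)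
    ... | inj₁ mx = ∈-++⁺ˡ (members⁺ {S = X} mx)
    ... | inj₂ mi with image⁻ {f = γ} mi
    ...   | i , iB , refl = ∈-++⁺ʳ (members X) (∈-map⁺ γ (members⁺ {S = B} iB))

  injection-onto : ∀ {n} {K : Subset n} (f : Fin ∣ K ∣ → Fin n) → (∀ {i j} → f i ≡ f j → i ≡ j)
                 → (∀ i → f i ∈ K) → ∀ {k} → k ∈ K → ∃[ i ] (f i ≡ k)
  injection-onto {n} {K} f f-inj f∈K k∈K with ∈-map⁻ f hit
    where
    open Pigeonhole (_≟_ {n})
    hit : _ ∈ₗ map f (allFin ∣ K ∣)
    hit = unique-⊆-covers (Unique.map⁺ f-inj (Unique.allFin⁺ ∣ K ∣))
            (λ m → case-map m)
            (subst₂ _≤_ (sym (members-length K)) (sym (trans (length-map f (allFin ∣ K ∣)) (length-tabulate (λ i → i)))) ≤-refl)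
            (members⁺ k∈K)
      where
      case-map : ∀ {x} → x ∈ₗ map f (allFin ∣ K ∣) → x ∈ₗ members K
      case-map m with ∈-map⁻ f m
      ... | i , _ , refl = members⁺ (f∈K i)
  ... | i , _ , eq = i , sym eq

  injection-onto-range : ∀ {m} (f : Fin m → ℕ) → (∀ {i j} → f i ≡ f j → i ≡ j)
                       → (∀ i → f i < m) → ∀ {j} → j < m → ∃[ i ] (f i ≡ j)
  injection-onto-range {m} f f-inj f<m j<m with ∈-map⁻ f hit
    where
    open Pigeonhole Nat._≟_
    hit : _ ∈ₗ map f (allFin m)
    hit = unique-⊆-covers (Unique.map⁺ f-inj (Unique.allFin⁺ m))
            (λ m' → in-range m')
            (subst₂ _≤_ (sym (length-upTo m)) (sym (trans (length-map f (allFin m)) (length-tabulate (λ i → i)))) ≤-refl)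
            (∈-upTo⁺ j<m)
      where
      in-range : ∀ {x} → x ∈ₗ map f (allFin m) → x ∈ₗ upTo m
      in-range m' with ∈-map⁻ f m'
      ... | i , _ , refl = ∈-upTo⁺ (f<m i)
  ... | i , _ , eq = i , sym eq

module ModifiedNetwork where

  open import Defs
  open import Data.Nat using (ℕ)
  open import Data.Fin using (Fin)
  open import Data.List using (List; map; _++_)
  open import Data.List.Membership.Propositional using (_∈_)
  open import Data.List.Membership.Propositional.Properties using (∈-map⁺; ∈-++⁺ˡ; ∈-++⁺ʳ)
  open import Data.Product using (_,_)
  open import Data.Sum using (_⊎_; inj₁; inj₂)
  open import Relation.Binary.PropositionalEquality using (_≡_; _≢_; refl)
  open Finiteness

  module _ {n : ℕ} (N : Network n) where
    open Network N

    private
      G : Digraph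
      G = Modified N

      vertexCode : MV N → Fin nV ⊎ (Fin nV ⊎ (Fin n ⊎ Fin n))
      vertexCode (vin x) = inj₁ x
      vertexCode (vout x) = inj₂ (inj₁ x)
      vertexCode (shat i) = inj₂ (inj₂ (inj₁ i))
      vertexCode (that j) = inj₂ (inj₂ (inj₂ j))

      vertexOf : Fin nV ⊎ (Fin nV ⊎ (Fin n ⊎ Fin n)) → MV N
      vertexOf (inj₁ x) = vin x
      vertexOf (inj₂ (inj₁ x)) = vout x
      vertexOf (inj₂ (inj₂ (inj₁ i))) = shat i
      vertexOf (inj₂ (inj₂ (inj₂ j))) = that j

      vertexOf-code : ∀ v → vertexOf (vertexCode v) ≡ v
      vertexOf-code (vin x) = refl
      vertexOf-code (vout x) = refl
      vertexOf-code (shat i) = refl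
      vertexOf-code (that j) = refl

      edgeCode : ME N → Fin nV ⊎ (Fin nE ⊎ (Fin n ⊎ Fin n))
      edgeCode (split x) = inj₁ x
      edgeCode (orig x) = inj₂ (inj₁ x)
      edgeCode (sedge i) = inj₂ (inj₂ (inj₁ i))
      edgeCode (tedge j) = inj₂ (inj₂ (inj₂ j))

      edgeOf : Fin nV ⊎ (Fin nE ⊎ (Fin n ⊎ Fin n)) → ME N
      edgeOf (inj₁ x) = split x
      edgeOf (inj₂ (inj₁ x)) = orig x
      edgeOf (inj₂ (inj₂ (inj₁ i))) = sedge i
      edgeOf (inj₂ (inj₂ (inj₂ j))) = tedge j

      edgeOf-code : ∀ e → edgeOf (edgeCode e) ≡ e
      edgeOf-code (split x) = refl
      edgeOf-code (orig x) = refl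
      edgeOf-code (sedge i) = refl
      edgeOf-code (tedge j) = refl

      four : ∀ a b c d → FiniteType (Fin a ⊎ (Fin b ⊎ (Fin c ⊎ Fin d)))
      four a b c d = ⊎-finite (Fin-finite a) (⊎-finite (Fin-finite b) (⊎-finite (Fin-finite c) (Fin-finite d)))

    vertices-finite : FiniteType (MV N)
    vertices-finite = retract (four nV nV n n) vertexCode vertexOf vertexOf-code

    edges-finite : FiniteType (ME N)
    edges-finite = retract (four nV nE n n) edgeCode edgeOf edgeOf-code

    allSteps : List (Step G)
    allSteps = map (_, fwd) edges ++ map (_, bwd) edges
      where edges = FiniteType.enumeration edges-finite

    ∈-allSteps : ∀ s → s ∈ allSteps
    ∈-allSteps (e , fwd) = ∈-++⁺ˡ (∈-map⁺ (_, fwd) (FiniteType.∈-enumeration edges-finite e))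
    ∈-allSteps (e , bwd) = ∈-++⁺ʳ (map (_, fwd) (FiniteType.enumeration edges-finite))
                                  (∈-map⁺ (_, bwd) (FiniteType.∈-enumeration edges-finite e))

    tl-vin : ∀ {e z} → mtl N e ≡ vin z → e ≡ split z
    tl-vin {split x} refl = refl
    tl-vin {orig x} ()
    tl-vin {sedge x} ()
    tl-vin {tedge x} ()

    hd-vout : ∀ {e z} → mhd N e ≡ vout z → e ≡ split z
    hd-vout {split x} refl = refl
    hd-vout {orig x} ()
    hd-vout {sedge x} ()
    hd-vout {tedge x} ()

    tl-shat : ∀ {e k} → mtl N e ≡ shat k → e ≡ sedge k
    tl-shat {split x} ()
    tl-shat {orig x} ()
    tl-shat {sedge x} refl = refl
    tl-shat {tedge x} ()

    hd-that : ∀ {e k} → mhd N e ≡ that k → e ≡ tedge k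
    hd-that {split x} ()
    hd-that {orig x} ()
    hd-that {sedge x} ()
    hd-that {tedge x} refl = refl

    hd-shat : ∀ {e k} → mhd N e ≢ shat k
    hd-shat {split x} ()
    hd-shat {orig x} ()
    hd-shat {sedge x} ()
    hd-shat {tedge x} ()

    tl-that : ∀ {e k} → mtl N e ≢ that k
    tl-that {split x} ()
    tl-that {orig x} ()
    tl-that {sedge x} ()
    tl-that {tedge x} ()

module FlowFacts where

  open import Defs
  open import Data.Nat using (ℕ; _<_)
  open import Data.Fin using (Fin; toℕ)
  import Data.Fin as Fin
  open import Data.Fin.Properties using (toℕ-injective; any?)
  open import Data.Fin.Subset using (Subset; _∈_; ∣_∣)
  open import Data.List using ([])
  import Data.List.Relation.Unary.All as All
  open import Data.List.Membership.Propositional using () renaming (_∈_ to _∈ₗ_)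
  open import Data.List.Membership.Propositional.Properties using (∈-map⁺)
  open import Data.Product using (∃-syntax; _×_; _,_; proj₁; proj₂)
  open import Data.Sum using (inj₁; inj₂)
  open import Data.Empty using (⊥-elim)
  open import Relation.Nullary using (Dec; yes; no)
  open import Relation.Binary.PropositionalEquality using (_≡_; _≢_; refl; sym; trans; cong; subst)
  open WalkFacts
  open Finiteness
  open ModifiedNetwork
  open SubsetFacts using (injection-onto; injection-onto-range)

  module Of {n : ℕ} (N : Network n) {K : Subset n} (φ : Flow N K) where
    open Flow φ

    private
      G : Digraph
      G = Modified N

    E : ME N → Set
    E = InFlow N φ

    E? : ∀ e → Dec (E e)
    E? e = any? (λ i → e ∈? edgesW G (path i))
      where open import Data.List.Membership.DecPropositional (FiniteType._≟_ (edges-finite N)) using (_∈?_)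

    private
      fwd-step : ∀ {i e} → e ∈ₗ edgesW G (path i) → (e , fwd) ∈ₗ steps (path i)
      fwd-step {i} = directed-step G (directed i)

      step-edge : ∀ {i e d} → (e , d) ∈ₗ steps (path i) → E e
      step-edge {i} m = i , ∈-map⁺ proj₁ m

      step-fwd : ∀ {i s} → s ∈ₗ steps (path i) → s ≡ (proj₁ s , fwd)
      step-fwd {i} {e , d} m with All.lookup (directed i) m
      ... | refl = refl

    same-tail : ∀ {e1 e2} → E e1 → E e2 → mtl N e1 ≡ mtl N e2 → e1 ≡ e2
    same-tail (i , m1) (j , m2) eq with i Fin.≟ j
    ... | yes refl = cong proj₁ (simple⇒src-injective G (valid (path i)) (simple i) (fwd-step m1) (fwd-step m2) eq)
    ... | no ne = ⊥-elim (disjoint i j ne _ (src∈verts G (valid (path i)) (fwd-step m1))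
                   (subst (_∈ₗ verts G (path j)) (sym eq) (src∈verts G (valid (path j)) (fwd-step m2))))

    same-head : ∀ {e1 e2} → E e1 → E e2 → mhd N e1 ≡ mhd N e2 → e1 ≡ e2
    same-head (i , m1) (j , m2) eq with i Fin.≟ j
    ... | yes refl = cong proj₁ (simple⇒tgt-injective G (valid (path i)) (simple i) (fwd-step m1) (fwd-step m2) eq)
    ... | no ne = ⊥-elim (disjoint i j ne _ (tailList⊆ G (tgt∈tailVerts G (valid (path i)) (fwd-step m1)))
                   (subst (_∈ₗ verts G (path j)) (sym eq) (tailList⊆ G (tgt∈tailVerts G (valid (path j)) (fwd-step m2)))))

    continues : ∀ {e} → E e → (∀ j → mhd N e ≢ that j) → ∃[ e' ] (E e' × mtl N e' ≡ mhd N e)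
    continues (i , m) not-sink with next-step G (valid (path i)) (fwd-step m)
    ... | inj₁ eq with toT i
    ...   | j , _ , fe = ⊥-elim (not-sink j (trans eq fe))
    continues (i , m) not-sink | inj₂ (s' , m' , eq) with step-fwd m'
    ...   | refl = proj₁ s' , step-edge m' , eq

    preceded : ∀ {e} → E e → (∀ k → mtl N e ≢ shat k) → ∃[ e' ] (E e' × mhd N e' ≡ mtl N e)
    preceded (i , m) not-source with previous-step G (valid (path i)) (fwd-step m)
    ... | inj₁ eq with fromS i
    ...   | k , _ , se = ⊥-elim (not-source k (trans eq se))
    preceded (i , m) not-source | inj₂ (s' , m' , eq) with step-fwd m'
    ...   | refl = proj₁ s' , step-edge m' , eq

    source-in-K : ∀ {k} → E (sedge k) → k ∈ K
    source-in-K (i , m) with previous-step G (valid (path i)) (fwd-step m)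
    ... | inj₂ (s' , m' , eq) with step-fwd m'
    ...   | refl = ⊥-elim (hd-shat N eq)
    source-in-K (i , m) | inj₁ eq with fromS i
    ...   | k , k∈K , se with trans eq se
    ...     | refl = k∈K

    sink-below-∣K∣ : ∀ {j} → E (tedge j) → toℕ j < ∣ K ∣
    sink-below-∣K∣ (i , m) with next-step G (valid (path i)) (fwd-step m)
    ... | inj₂ (s' , m' , eq) with step-fwd m'
    ...   | refl = ⊥-elim (tl-that N eq)
    sink-below-∣K∣ (i , m) | inj₁ eq with toT i
    ...   | j , lt , fe with trans eq fe
    ...     | refl = lt

    -- a flow path runs from a source to a sink, so it has a step
    nonempty : ∀ i → steps (path i) ≢ []
    nonempty i eq with fromS i | toT i
    ... | k , _ , se | j , _ , fe with trans (sym se) (trans (sym (closed eq)) fe)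
      where
      closed : steps (path i) ≡ [] → finish G (path i) ≡ start (path i)
      closed q rewrite q = refl
    ... | ()

    startIdx : Fin ∣ K ∣ → Fin n
    startIdx i = proj₁ (fromS i)

    startIdx-injective : ∀ {i j} → startIdx i ≡ startIdx j → i ≡ j
    startIdx-injective {i} {j} eq with i Fin.≟ j
    ... | yes p = p
    ... | no ne = ⊥-elim (disjoint i j ne (start (path i)) (start∈verts G _ _)
             (subst (_∈ₗ verts G (path j)) same-start (start∈verts G _ _)))
      where
      same-start : start (path j) ≡ start (path i)
      same-start = trans (proj₂ (proj₂ (fromS j))) (trans (cong shat (sym eq)) (sym (proj₂ (proj₂ (fromS i)))))

    endIdx : Fin ∣ K ∣ → ℕ
    endIdx i = toℕ (proj₁ (toT i))

    endIdx-injective : ∀ {i j} → endIdx i ≡ endIdx j → i ≡ j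
    endIdx-injective {i} {j} eq with i Fin.≟ j
    ... | yes p = p
    ... | no ne = ⊥-elim (disjoint i j ne (finish G (path i)) (end∈verts G _ _)
             (subst (_∈ₗ verts G (path j)) same-end (end∈verts G _ _)))
      where
      same-end : finish G (path j) ≡ finish G (path i)
      same-end = trans (proj₂ (proj₂ (toT j)))
                   (trans (cong that (toℕ-injective (sym eq))) (sym (proj₂ (proj₂ (toT i)))))

    -- by counting, every source of Ŝ_K is used ...
    uses-source : ∀ {k} → k ∈ K → E (sedge k)
    uses-source k∈K with injection-onto startIdx startIdx-injective (λ i → proj₁ (proj₂ (fromS i))) k∈K
    ... | i , refl with first-step G (valid (path i)) (nonempty i)
    ...   | s , m , src≡ with step-fwd m
    ...     | refl with tl-shat N (trans src≡ (proj₂ (proj₂ (fromS i))))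
    ...       | refl = step-edge m

    uses-sink : ∀ {j} → toℕ j < ∣ K ∣ → E (tedge j)
    uses-sink lt with injection-onto-range endIdx endIdx-injective (λ i → proj₁ (proj₂ (toT i))) lt
    ... | i , eqj with last-step G (valid (path i)) (nonempty i)
    ...   | s , m , tgt≡ with step-fwd m
    ...     | refl with hd-that N (trans tgt≡ (proj₂ (proj₂ (toT i))))
    ...       | refl with toℕ-injective eqj
    ...         | refl = step-edge m

open import Defs
open import Data.Nat using (ℕ; _+_; _∸_; _≤_; _<_; _<?_)
open import Data.Nat.Properties using (≤-trans; +-monoʳ-≤; m+n∸m≡n; ≮⇒≥)
open import Data.Fin using (Fin; toℕ; cast)
open import Data.Fin.Properties using (toℕ-injective; toℕ-cast; <-cmp; <-irrefl)
open import Data.Fin.Subset using (Subset; _∈_; _∉_; _∪_; ∁; ∣_∣)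
open import Data.Fin.Subset.Properties using (_∈?_; x∈p∪q⁻; x∈p∪q⁺; ∣∁p∣≡n∸∣p∣; x∈∁p⇒x∉p)
open import Data.List using (length; lookup)
open import Data.List.Relation.Unary.All using (All)
import Data.List.Relation.Unary.All as All
import Data.List.Relation.Unary.Any as Any
open import Data.List.Relation.Unary.Any.Properties using (lookup-index)
open import Data.List.Membership.Propositional using () renaming (_∈_ to _∈ₗ_)
open import Data.List.Membership.Propositional.Properties using (∈-map⁺; ∈-map⁻; ∈-lookup)
open import Data.Product using (∃-syntax; _×_; _,_; proj₁; proj₂)
open import Data.Sum using (_⊎_; inj₁; inj₂)
open import Data.Empty using (⊥; ⊥-elim)
open import Relation.Nullary using (¬_; Dec; yes; no; ¬?)
open import Relation.Nullary.Decidable using (_×-dec_)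
open import Relation.Binary using (tri<; tri≈; tri>)
open import Relation.Binary.PropositionalEquality
  using (_≡_; _≢_; refl; sym; trans; cong; subst; subst₂; module ≡-Reasoning)

module SymmetricDifference {n} (N : Network n) (p q : ℕ) (q≤p : q ≤ p)
  (X Y : Subset n) (X∩Y=∅ : ∀ i → i ∈ X → i ∈ Y → ⊥)
  (γ : Fin (p + q) → Fin n) (γ-order : IsOrderBij γ Y)
  (A : Subset (p + q)) (∣A∣≡p : ∣ A ∣ ≡ p)
  (φ : Flow N (X ∪ image γ A)) (φ' : Flow N (X ∪ image γ (∁ A))) where

  open WalkFacts
  open Finiteness
  open ModifiedNetwork
  open SubsetFacts
  open ListFacts using (lookup-injective)

  G : Digraph
  G = Modified N

  I J : Subset n
  I = X ∪ image γ A
  J = X ∪ image γ (∁ A)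

  open FlowFacts.Of N φ renaming
    (E to Eφ; E? to Eφ?; same-tail to same-tailφ; same-head to same-headφ; continues to continuesφ;
     preceded to precededφ; source-in-K to source-in-I; sink-below-∣K∣ to sink-below-∣I∣;
     uses-source to uses-sourceφ; uses-sink to uses-sinkφ)
    using ()
  open FlowFacts.Of N φ' renaming
    (E to Eφ'; E? to Eφ'?; same-tail to same-tailφ'; same-head to same-headφ'; continues to continuesφ';
     preceded to precededφ'; source-in-K to source-in-J; sink-below-∣K∣ to sink-below-∣J∣;
     uses-source to uses-sourceφ'; uses-sink to uses-sinkφ')
    using ()

  γ-injective : ∀ {i j} → γ i ≡ γ j → i ≡ j
  γ-injective {i} {j} eq with <-cmp i j
  ... | tri< lt _ _ = ⊥-elim (<-irrefl eq (proj₁ γ-order i j lt))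
  ... | tri≈ _ e _ = e
  ... | tri> _ _ gt = ⊥-elim (<-irrefl (sym eq) (proj₁ γ-order j i gt))

  γ∉X : ∀ i → γ i ∈ X → ⊥
  γ∉X i m = X∩Y=∅ (γ i) m (proj₁ (proj₂ γ-order) i)

  ∣I∣ : ∣ I ∣ ≡ ∣ X ∣ + p
  ∣I∣ = trans (∣X∪image∣ γ γ-injective X γ∉X A) (cong (∣ X ∣ +_) ∣A∣≡p)

  ∣J∣ : ∣ J ∣ ≡ ∣ X ∣ + q
  ∣J∣ = trans (∣X∪image∣ γ γ-injective X γ∉X (∁ A))
              (cong (∣ X ∣ +_) (trans (∣∁p∣≡n∸∣p∣ A) (trans (cong ((p + q) ∸_) ∣A∣≡p) (m+n∸m≡n p q))))

  ∣J∣≤∣I∣ : ∣ J ∣ ≤ ∣ I ∣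
  ∣J∣≤∣I∣ = subst₂ _≤_ (sym ∣J∣) (sym ∣I∣) (+-monoʳ-≤ ∣ X ∣ q≤p)

  γA∉J : ∀ {a} → a ∈ A → γ a ∉ J
  γA∉J {a} a∈A m with x∈p∪q⁻ X (image γ (∁ A)) m
  ... | inj₁ m∈X = γ∉X a m∈X
  ... | inj₂ m∈γĀ with image⁻ {f = γ} {A = ∁ A} m∈γĀ
  ...   | b , b∈Ā , eq with γ-injective eq
  ...     | refl = x∈∁p⇒x∉p b∈Ā a∈A

  Arr : Step G → Set
  Arr (e , fwd) = Eφ e × ¬ Eφ' e
  Arr (e , bwd) = Eφ' e × ¬ Eφ e

  Arr? : ∀ s → Dec (Arr s)
  Arr? (e , fwd) = Eφ? e ×-dec ¬? (Eφ'? e)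
  Arr? (e , bwd) = Eφ'? e ×-dec ¬? (Eφ? e)

  arr-det : ∀ {e d d'} → Arr (e , d) → Arr (e , d') → d ≡ d'
  arr-det {d = fwd} {fwd} a a' = refl
  arr-det {d = fwd} {bwd} a a' = ⊥-elim (proj₂ a' (proj₁ a))
  arr-det {d = bwd} {fwd} a a' = ⊥-elim (proj₂ a (proj₁ a'))
  arr-det {d = bwd} {bwd} a a' = refl

  private
    not-source : ∀ {e v} → mtl N e ≡ v → (∀ {k} → v ≢ shat k) → ∀ k → mtl N e ≢ shat k
    not-source refl v≢ k = v≢
    not-sink : ∀ {e v} → mhd N e ≡ v → (∀ {j} → v ≢ that j) → ∀ j → mhd N e ≢ that j
    not-sink refl v≢ j = v≢
    vin≢shat : ∀ {x k} → vin {N = N} x ≢ shat k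
    vin≢shat ()
    vout≢shat : ∀ {x k} → vout {N = N} x ≢ shat k
    vout≢shat ()
    vin≢that : ∀ {x j} → vin {N = N} x ≢ that j
    vin≢that ()
    vout≢that : ∀ {x j} → vout {N = N} x ≢ that j
    vout≢that ()

  -- A forward and a backward arrow never leave the same vertex: the
  -- common vertex would carry a φ-edge and a φ'-edge in a way that forces
  -- one of them into both flows.
  fwd-bwd-sources : ∀ {e1 e2} → Eφ e1 → ¬ Eφ' e1 → Eφ' e2 → ¬ Eφ e2 → mtl N e1 ≡ mhd N e2 → ⊥
  fwd-bwd-sources {e1} {split y} a1 n1 a2 n2 eq with precededφ a1 (not-source eq vout≢shat)
  ... | e' , ae' , he' with hd-vout N (trans he' eq)
  ...   | refl = n2 ae'
  fwd-bwd-sources {e1} {orig x} a1 n1 a2 n2 eq with tl-vin N eq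
  ... | refl with continuesφ' a2 (not-sink {e = orig x} refl vin≢that)
  ...   | e'' , ae'' , te'' with tl-vin N te''
  ...     | refl = n1 ae''
  fwd-bwd-sources {e1} {sedge i} a1 n1 a2 n2 eq with tl-vin N eq
  ... | refl with continuesφ' a2 (not-sink {e = sedge i} refl vin≢that)
  ...   | e'' , ae'' , te'' with tl-vin N te''
  ...     | refl = n1 ae''
  fwd-bwd-sources {e1} {tedge j} a1 n1 a2 n2 eq = tl-that N eq

  fwd-bwd-targets : ∀ {e1 e2} → Eφ e1 → ¬ Eφ' e1 → Eφ' e2 → ¬ Eφ e2 → mhd N e1 ≡ mtl N e2 → ⊥
  fwd-bwd-targets {split y} {e2} a1 n1 a2 n2 eq with precededφ' a2 (not-source (sym eq) vout≢shat)
  ... | e' , ae' , he' with hd-vout N (trans he' (sym eq))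
  ...   | refl = n1 ae'
  fwd-bwd-targets {orig x} {e2} a1 n1 a2 n2 eq with tl-vin N (sym eq)
  ... | refl with continuesφ a1 (not-sink {e = orig x} refl vin≢that)
  ...   | e'' , ae'' , te'' with tl-vin N te''
  ...     | refl = n2 ae''
  fwd-bwd-targets {sedge i} {e2} a1 n1 a2 n2 eq with tl-vin N (sym eq)
  ... | refl with continuesφ a1 (not-sink {e = sedge i} refl vin≢that)
  ...   | e'' , ae'' , te'' with tl-vin N te''
  ...     | refl = n2 ae''
  fwd-bwd-targets {tedge j} {e2} a1 n1 a2 n2 eq = tl-that N (sym eq)

  arr-src-inj : ∀ {s1 s2} → Arr s1 → Arr s2 → stepSrc G s1 ≡ stepSrc G s2 → s1 ≡ s2
  arr-src-inj {e1 , fwd} {e2 , fwd} a1 a2 eq = cong (_, fwd) (same-tailφ (proj₁ a1) (proj₁ a2) eq)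
  arr-src-inj {e1 , bwd} {e2 , bwd} a1 a2 eq = cong (_, bwd) (same-headφ' (proj₁ a1) (proj₁ a2) eq)
  arr-src-inj {e1 , fwd} {e2 , bwd} (a1 , n1) (a2 , n2) eq = ⊥-elim (fwd-bwd-sources a1 n1 a2 n2 eq)
  arr-src-inj {e1 , bwd} {e2 , fwd} (a1 , n1) (a2 , n2) eq = ⊥-elim (fwd-bwd-sources a2 n2 a1 n1 (sym eq))

  arr-tgt-inj : ∀ {s1 s2} → Arr s1 → Arr s2 → stepTgt G s1 ≡ stepTgt G s2 → s1 ≡ s2
  arr-tgt-inj {e1 , fwd} {e2 , fwd} a1 a2 eq = cong (_, fwd) (same-headφ (proj₁ a1) (proj₁ a2) eq)
  arr-tgt-inj {e1 , bwd} {e2 , bwd} a1 a2 eq = cong (_, bwd) (same-tailφ' (proj₁ a1) (proj₁ a2) eq)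
  arr-tgt-inj {e1 , fwd} {e2 , bwd} (a1 , n1) (a2 , n2) eq = ⊥-elim (fwd-bwd-targets a1 n1 a2 n2 eq)
  arr-tgt-inj {e1 , bwd} {e2 , fwd} (a1 , n1) (a2 , n2) eq = ⊥-elim (fwd-bwd-targets a2 n2 a1 n1 (sym eq))

  open Arrows.Decompose G (vertices-finite N) (allSteps N) (∈-allSteps N) Arr Arr? arr-det arr-src-inj arr-tgt-inj
    public

  -- Balance at the split vertices v', v'': a vertex vin x or vout x has an
  -- outgoing arrow iff it has an incoming one.  Each case follows the flow
  -- path through the vertex one edge further.
  out⇒in-vin : ∀ x → HasOut (vin x) → HasIn (vin x)
  out⇒in-vin x ((e , fwd) , (Ee , nE'e) , src) with tl-vin N src
  ... | refl with precededφ Ee (not-source src vin≢shat)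
  ...   | e' , Ee' , he' with Eφ'? e'
  ...     | no nE' = (e' , fwd) , (Ee' , nE') , he'
  ...     | yes E'e' with continuesφ' E'e' (not-sink he' vin≢that)
  ...       | e'' , E'e'' , te'' with tl-vin N (trans te'' he')
  ...         | refl = ⊥-elim (nE'e E'e'')
  out⇒in-vin x ((e , bwd) , (E'e , nEe) , src) with continuesφ' E'e (not-sink src vin≢that)
  ... | e'' , E'e'' , te'' with tl-vin N (trans te'' src)
  ...   | refl with Eφ? (split x)
  ...     | no nE = (split x , bwd) , (E'e'' , nE) , refl
  ...     | yes Es with precededφ Es (not-source {e = split x} refl vin≢shat)
  ...       | e' , Ee' , he' with Eφ'? e'
  ...         | no nE' = (e' , fwd) , (Ee' , nE') , he'
  ...         | yes E'e' with same-headφ' E'e E'e' (trans src (sym he'))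
  ...           | refl = ⊥-elim (nEe Ee')

  in⇒out-vin : ∀ x → HasIn (vin x) → HasOut (vin x)
  in⇒out-vin x ((e , fwd) , (Ee , nE'e) , tgt) with continuesφ Ee (not-sink tgt vin≢that)
  ... | e'' , Ee'' , te'' with tl-vin N (trans te'' tgt)
  ...   | refl with Eφ'? (split x)
  ...     | no nE' = (split x , fwd) , (Ee'' , nE') , refl
  ...     | yes E's with precededφ' E's (not-source {e = split x} refl vin≢shat)
  ...       | e' , E'e' , he' with Eφ? e'
  ...         | no nE = (e' , bwd) , (E'e' , nE) , he'
  ...         | yes Ee' with same-headφ Ee Ee' (trans tgt (sym he'))
  ...           | refl = ⊥-elim (nE'e E'e')
  in⇒out-vin x ((e , bwd) , (E'e , nEe) , tgt) with tl-vin N tgt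
  ... | refl with precededφ' E'e (not-source tgt vin≢shat)
  ...   | e' , E'e' , he' with Eφ? e'
  ...     | no nE = (e' , bwd) , (E'e' , nE) , he'
  ...     | yes Ee' with continuesφ Ee' (not-sink he' vin≢that)
  ...       | e'' , Ee'' , te'' with tl-vin N (trans te'' he')
  ...         | refl = ⊥-elim (nEe Ee'')

  out⇒in-vout : ∀ x → HasOut (vout x) → HasIn (vout x)
  out⇒in-vout x ((e , fwd) , (Ee , nE'e) , src) with precededφ Ee (not-source src vout≢shat)
  ... | e' , Ee' , he' with hd-vout N (trans he' src)
  ...   | refl with Eφ'? (split x)
  ...     | no nE' = (split x , fwd) , (Ee' , nE') , refl
  ...     | yes E's with continuesφ' E's (not-sink {e = split x} refl vout≢that)
  ...       | e'' , E'e'' , te'' with Eφ? e''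
  ...         | no nE = (e'' , bwd) , (E'e'' , nE) , te''
  ...         | yes Ee'' with same-tailφ Ee Ee'' (trans src (sym te''))
  ...           | refl = ⊥-elim (nE'e E'e'')
  out⇒in-vout x ((e , bwd) , (E'e , nEe) , src) with hd-vout N src
  ... | refl with continuesφ' E'e (not-sink src vout≢that)
  ...   | e'' , E'e'' , te'' with Eφ? e''
  ...     | no nE = (e'' , bwd) , (E'e'' , nE) , te''
  ...     | yes Ee'' with precededφ Ee'' (not-source te'' vout≢shat)
  ...       | e' , Ee' , he' with hd-vout N (trans he' te'')
  ...         | refl = ⊥-elim (nEe Ee')

  in⇒out-vout : ∀ x → HasIn (vout x) → HasOut (vout x)
  in⇒out-vout x ((e , fwd) , (Ee , nE'e) , tgt) with hd-vout N tgt
  ... | refl with continuesφ Ee (not-sink tgt vout≢that)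
  ...   | e'' , Ee'' , te'' with Eφ'? e''
  ...     | no nE' = (e'' , fwd) , (Ee'' , nE') , te''
  ...     | yes E'e'' with precededφ' E'e'' (not-source te'' vout≢shat)
  ...       | e' , E'e' , he' with hd-vout N (trans he' te'')
  ...         | refl = ⊥-elim (nE'e E'e')
  in⇒out-vout x ((e , bwd) , (E'e , nEe) , tgt) with precededφ' E'e (not-source tgt vout≢shat)
  ... | e' , E'e' , he' with hd-vout N (trans he' tgt)
  ...   | refl with Eφ? (split x)
  ...     | no nE = (split x , bwd) , (E'e' , nE) , refl
  ...     | yes Es with continuesφ Es (not-sink {e = split x} refl vout≢that)
  ...       | e'' , Ee'' , te'' with Eφ'? e''
  ...         | no nE' = (e'' , fwd) , (Ee'' , nE') , te''
  ...         | yes E'e'' with same-tailφ' E'e E'e'' (trans tgt (sym te''))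
  ...           | refl = ⊥-elim (nEe Ee'')

  path-start-shape : ∀ v → HasOut v → ¬ HasIn v → ∃[ a ] (a ∈ A × v ≡ shat (γ a))
  path-start-shape (vin x) ho nhi = ⊥-elim (nhi (out⇒in-vin x ho))
  path-start-shape (vout x) ho nhi = ⊥-elim (nhi (out⇒in-vout x ho))
  path-start-shape (shat k) ((e , fwd) , (Ee , nE'e) , src) nhi with tl-shat N src
  ... | refl with k ∈? J
  ...   | yes k∈J = ⊥-elim (nE'e (uses-sourceφ' k∈J))
  ...   | no k∉J with x∈p∪q⁻ X (image γ A) (source-in-I Ee)
  ...     | inj₁ kX = ⊥-elim (k∉J (x∈p∪q⁺ (inj₁ kX)))
  ...     | inj₂ ki with image⁻ {f = γ} {A = A} ki
  ...       | a , aA , eq = a , aA , cong shat (sym eq)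
  path-start-shape (shat k) ((e , bwd) , _ , src) nhi = ⊥-elim (hd-shat N src)
  path-start-shape (that j) ((e , fwd) , _ , src) nhi = ⊥-elim (tl-that N src)
  path-start-shape (that j) ((e , bwd) , (E'e , nEe) , src) nhi with hd-that N src
  ... | refl = ⊥-elim (nEe (uses-sinkφ (≤-trans (sink-below-∣J∣ E'e) ∣J∣≤∣I∣)))

  path-end-shape : ∀ v → HasIn v → ¬ HasOut v → OtherEnd N p q X γ A Eφ Eφ' v
  path-end-shape (vin x) hi nho = ⊥-elim (nho (in⇒out-vin x hi))
  path-end-shape (vout x) hi nho = ⊥-elim (nho (in⇒out-vout x hi))
  path-end-shape (shat k) ((e , fwd) , _ , tgt) nho = ⊥-elim (hd-shat N tgt)
  path-end-shape (shat k) ((e , bwd) , (E'e , nEe) , tgt) nho with tl-shat N tgt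
  ... | refl with k ∈? I
  ...   | yes k∈I = ⊥-elim (nEe (uses-sourceφ k∈I))
  ...   | no k∉I with x∈p∪q⁻ X (image γ (∁ A)) (source-in-J E'e)
  ...     | inj₁ kX = ⊥-elim (k∉I (x∈p∪q⁺ (inj₁ kX)))
  ...     | inj₂ ki with image⁻ {f = γ} {A = ∁ A} ki
  ...       | b , bA , eq = inj₁ (b , x∈∁p⇒x∉p bA , cong shat (sym eq))
  path-end-shape (that j) ((e , bwd) , _ , tgt) nho = ⊥-elim (tl-that N tgt)
  path-end-shape (that j) ((e , fwd) , (Ee , nE'e) , tgt) nho with hd-that N tgt
  ... | refl with toℕ j <? ∣ J ∣
  ...   | yes lt = ⊥-elim (nE'e (uses-sinkφ' lt))
  ...   | no nlt = inj₂ (j , subst (_≤ toℕ j) ∣J∣ (≮⇒≥ nlt) , subst (toℕ j <_) ∣I∣ (sink-below-∣I∣ Ee) , refl)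

  γA-source-arrow : ∀ {a} → a ∈ A → Arr (sedge (γ a) , fwd)
  γA-source-arrow {a} aA = uses-sourceφ (x∈p∪q⁺ (inj₂ (image⁺ {f = γ} {A = A} aA))) , λ E' → γA∉J aA (source-in-J E')

  γA-source-noIn : ∀ {a} → a ∈ A → ¬ HasIn (shat (γ a))
  γA-source-noIn aA ((e , fwd) , _ , tgt) = hd-shat N tgt
  γA-source-noIn aA ((e , bwd) , (E'e , _) , tgt) with tl-shat N tgt
  ... | refl = γA∉J aA (source-in-J E'e)

  private
    members-A : length (members A) ≡ p
    members-A = trans (members-length A) ∣A∣≡p

  a : Fin p → Fin (p + q)
  a k = lookup (members A) (cast (sym members-A) k)

  a∈A : ∀ k → a k ∈ A
  a∈A k = members⁻ {S = A} (∈-lookup (cast (sym members-A) k))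

  a-injective : ∀ {k l} → a k ≡ a l → k ≡ l
  a-injective {k} {l} eq = toℕ-injective (begin
    toℕ k                        ≡⟨ toℕ-cast (sym members-A) k ⟨
    toℕ (cast (sym members-A) k) ≡⟨ cong toℕ (lookup-injective (members-unique A) _ _ eq) ⟩
    toℕ (cast (sym members-A) l) ≡⟨ toℕ-cast (sym members-A) l ⟩
    toℕ l                        ∎)
    where open ≡-Reasoning

  a-surjective : ∀ {b} → b ∈ A → ∃[ k ] (a k ≡ b)
  a-surjective {b} b∈A = cast members-A i , trans (cong (lookup (members A)) cast-cast) (sym (lookup-index m))
    where
    m : b ∈ₗ members A
    m = members⁺ {S = A} b∈A
    i : Fin (length (members A))
    i = Any.index m
    cast-cast : cast (sym members-A) (cast members-A i) ≡ i
    cast-cast = toℕ-injective (trans (toℕ-cast (sym members-A) (cast members-A i)) (toℕ-cast members-A i))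

  starts : Fin p → MV N
  starts k = shat (γ (a k))

  starts-injective : ∀ k l → starts k ≡ starts l → k ≡ l
  starts-injective k l eq = a-injective (γ-injective (shat-injective eq))
    where
    shat-injective : ∀ {i j : Fin n} → shat {N = N} i ≡ shat j → i ≡ j
    shat-injective refl = refl

  starts-cover : ∀ v → HasOut v → ¬ HasIn v → ∃[ k ] (starts k ≡ v)
  starts-cover v has-out no-in with path-start-shape v has-out no-in
  ... | b , b∈A , refl with a-surjective b∈A
  ...   | k , refl = k , refl

  open Paths p starts (λ k → γA-source-noIn (a∈A k)) starts-injective starts-cover public

  arrow∈Δ : ∀ {s} → Arr s → Δ N p q X γ A Eφ Eφ' (proj₁ s)
  arrow∈Δ {e , fwd} arr = inj₁ arr
  arrow∈Δ {e , bwd} arr = inj₂ arr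

  arrows⊆Δ : ∀ {w} → All Arr (steps w) → ∀ e → e ∈ₗ edgesW G w → Δ N p q X γ A Eφ Eφ' e
  arrows⊆Δ arrows e m with ∈-map⁻ proj₁ m
  ... | s , m' , refl = arrow∈Δ (All.lookup arrows m')

  arrows-alternate : ∀ {w} → All Arr (steps w) → Alternating N p q X γ A Eφ Eφ' w
  arrows-alternate arrows = inj₁ (All.map φ-forward arrows , All.map φ'-backward arrows)
    where
    φ-forward : ∀ {s} → Arr s → Eφ (proj₁ s) → proj₂ s ≡ fwd
    φ-forward {e , fwd} _ _ = refl
    φ-forward {e , bwd} (_ , ¬Eφe) Eφe = ⊥-elim (¬Eφe Eφe)
    φ'-backward : ∀ {s} → Arr s → Eφ' (proj₁ s) → proj₂ s ≡ bwd
    φ'-backward {e , fwd} (_ , ¬Eφ'e) Eφ'e = ⊥-elim (¬Eφ'e Eφ'e)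
    φ'-backward {e , bwd} _ _ = refl

  on-edges : ∀ {s} → (∃[ k ] (s ∈ₗ steps (C k))) ⊎ (∃[ k ] (s ∈ₗ steps (P k)))
           → (∃[ k ] (proj₁ s ∈ₗ edgesW G (C k))) ⊎ (∃[ k ] (proj₁ s ∈ₗ edgesW G (P k)))
  on-edges (inj₁ (k , m)) = inj₁ (k , ∈-map⁺ proj₁ m)
  on-edges (inj₂ (k , m)) = inj₂ (k , ∈-map⁺ proj₁ m)

  cover-Δ : ∀ e → Δ N p q X γ A Eφ Eφ' e
          → (∃[ k ] (e ∈ₗ edgesW G (C k))) ⊎ (∃[ k ] (e ∈ₗ edgesW G (P k)))
  cover-Δ e (inj₁ arr) = on-edges (cover {e , fwd} arr)
  cover-Δ e (inj₂ arr) = on-edges (cover {e , bwd} arr)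

  P-ends : ∀ k → Connects N p q X γ A Eφ Eφ' (P k)
  P-ends k = inj₁ ((a k , a∈A k , refl) , path-end-shape _ end-in end-no-out)
    where
    ends : HasIn (finish G (P k)) × ¬ HasOut (finish G (P k))
    ends = P-end k ((sedge (γ (a k)) , fwd) , γA-source-arrow (a∈A k) , refl)
    end-in : HasIn (finish G (P k))
    end-in = proj₁ ends
    end-no-out : ¬ HasOut (finish G (P k))
    end-no-out = proj₂ ends

lemma1 : ∀ {n} (N : Network n) → Network.Acyclic N → Network.WeaklyConnected N
    → (p q : ℕ) → q ≤ p → 1 ≤ q
    → (X Y : Subset n) → (∀ i → i ∈ X → i ∈ Y → ⊥) → ∣ Y ∣ ≡ p + q
    → (γ : Fin (p + q) → Fin n) → IsOrderBij γ Y
    → (A : Subset (p + q)) → ∣ A ∣ ≡ p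
    → (φ : Flow N (X ∪ image γ A)) → (φ' : Flow N (X ∪ image γ (∁ A)))
    → Decomposition N p q X γ A (InFlow N φ) (InFlow N φ')
lemma1 N _ _ p q q≤p _ X Y X∩Y=∅ _ γ γ-order A ∣A∣≡p φ φ' = record
  { d        = d
  ; C        = C
  ; P        = P
  ; C-circ   = C-circ
  ; P-simple = P-simple
  ; cover    = cover-Δ
  ; C-in-Δ   = λ k → arrows⊆Δ {C k} (C-arr k)
  ; P-in-Δ   = λ k → arrows⊆Δ {P k} (P-arr k)
  ; disjCC   = disjCC
  ; disjPP   = disjPP
  ; disjCP   = disjCP
  ; P-ends   = P-ends
  ; C-alt    = λ k → arrows-alternate {C k} (C-arr k)
  ; P-alt    = λ k → arrows-alternate {P k} (P-arr k)
  }
  where open SymmetricDifference N p q q≤p X Y X∩Y=∅ γ γ-order A ∣A∣≡p φ φ'
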